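{- Let a moding be fixed. Let $Q$ be a tidy query and let $C$ be a tidy clause that is variable disjoint from $Q$. Then every SLD-resolvent $Q'$ of $Q$ and $C$ is tidy.
   Context: Programs are definite logic programs. A moding assigns to each argument position of each predicate either $+$ (input) or $-$ (output). For an atom $A$ we write $A=p(s;t)$ where $s$ is the sequence of terms in its input positions and $t$ the sequence of terms in its output positions. A syntactic object is linear if no variable occurs in it more than once. A query is output linear if the sequence of all terms occurring in output positions of its atoms is linear; an atom or query is input linear if the sequence of terms in its input positions is linear. For a query $Q=A_1,\ldots,A_n$ define a relation $\to_Q$ on $\{A_1,\ldots,A_n\}$ by $A_i\to_Q A_j$ iff some variable occurs in an output position of $A_i$ and in an input position of $A_j$. A query $Q$ is tidy if it is output linear and $\to_Q$ is acyclic (i.e. $A_i\not\to_Q^+ A_i$ for all $i$). A clause $H\gets Q$ is tidy if $Q$ is tidy, $H$ is input linear, and no variable occurring in an input position of $H$ occurs in an output position of $Q$. The atoms of a query are unordered for the purposes of resolution (any atom may be selected). -}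

module Defs where

open import Data.Nat using (ℕ; suc)
open import Data.Fin using (Fin; zero; suc)
open import Data.Vec using (Vec; []; _∷_)
open import Data.List using (List; []; _∷_; _++_; concatMap; length; lookup)
open import Data.List.Relation.Unary.Unique.Propositional using (Unique)
open import Data.List.Membership.Propositional using (_∈_; _∉_)
open import Data.Product using (Σ; ∃; _×_)
open import Relation.Binary.PropositionalEquality using (_≡_)
open import Relation.Binary.Construct.Closure.Transitive using (TransClosure)
open import Relation.Nullary using (¬_)

Var : Set
Var = ℕ

record Signature : Set₁ where
  field
    Fun        : Set
    fun-arity  : Fun → ℕ
    Pred       : Set
    pred-arity : Pred → ℕ

data Mode : Set where
  input output : Mode

Moding : Signature → Set
Moding Sg = (p : Signature.Pred Sg) → Fin (Signature.pred-arity Sg p) → Mode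

module LP (Sg : Signature) (moding : Moding Sg) where
  open Signature Sg

  data Term : Set where
    var : Var → Term
    fn  : (f : Fun) → Vec Term (fun-arity f) → Term

  Subst : Set
  Subst = Var → Term

  mutual
    _⟨_⟩ : Term → Subst → Term
    var x   ⟨ σ ⟩ = σ x
    fn f ts ⟨ σ ⟩ = fn f (ts ⟨ σ ⟩*)

    _⟨_⟩* : ∀ {n} → Vec Term n → Subst → Vec Term n
    []       ⟨ σ ⟩* = []
    (t ∷ ts) ⟨ σ ⟩* = (t ⟨ σ ⟩) ∷ (ts ⟨ σ ⟩*)

  mutual
    vars : Term → List Var
    vars (var x)   = x ∷ []
    vars (fn f ts) = vars* ts

    vars* : ∀ {n} → Vec Term n → List Var
    vars* []       = []
    vars* (t ∷ ts) = vars t ++ vars* ts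

  record Atom : Set where
    constructor atom
    field
      pred : Pred
      args : Vec Term (pred-arity pred)
  open Atom public

  Query : Set
  Query = List Atom

  record Clause : Set where
    constructor _←_
    field
      head : Atom
      body : Query
  open Clause public

  _⟨_⟩ₐ : Atom → Subst → Atom
  atom p ts ⟨ σ ⟩ₐ = atom p (ts ⟨ σ ⟩*)

  _⟨_⟩q : Query → Subst → Query
  []      ⟨ σ ⟩q = []
  (A ∷ Q) ⟨ σ ⟩q = (A ⟨ σ ⟩ₐ) ∷ (Q ⟨ σ ⟩q)

  select : ∀ {n} → (Fin n → Mode) → Mode → Vec Term n → List Term
  select md k [] = []
  select md k (t ∷ ts) with md zero | k
  ... | input  | input  = t ∷ select (λ i → md (suc i)) k ts
  ... | output | output = t ∷ select (λ i → md (suc i)) k ts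
  ... | input  | output = select (λ i → md (suc i)) k ts
  ... | output | input  = select (λ i → md (suc i)) k ts

  inTerms outTerms : Atom → List Term
  inTerms  (atom p ts) = select (moding p) input ts
  outTerms (atom p ts) = select (moding p) output ts

  inVars outVars varsA : Atom → List Var
  inVars  A = concatMap vars (inTerms A)
  outVars A = concatMap vars (outTerms A)
  varsA (atom p ts) = vars* ts

  outVarsQ varsQ : Query → List Var
  outVarsQ Q = concatMap outVars Q
  varsQ    Q = concatMap varsA Q

  varsC : Clause → List Var
  varsC C = varsA (head C) ++ varsQ (body C)

  Linear : List Var → Set
  Linear = Unique

  OutputLinear : Query → Set
  OutputLinear Q = Linear (outVarsQ Q)

  InputLinearAtom : Atom → Set
  InputLinearAtom A = Linear (inVars A)

  -- the relation →_Q on the atoms of Q (identified by their positions)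
  Arrow : (Q : Query) → Fin (length Q) → Fin (length Q) → Set
  Arrow Q i j = ∃ λ x → x ∈ outVars (lookup Q i) × x ∈ inVars (lookup Q j)

  Acyclic : (Q : Query) → Set
  Acyclic Q = (i : Fin (length Q)) → ¬ TransClosure (Arrow Q) i i

  TidyQuery : Query → Set
  TidyQuery Q = OutputLinear Q × Acyclic Q

  TidyClause : Clause → Set
  TidyClause C =
    TidyQuery (body C) × InputLinearAtom (head C) ×
    ((x : Var) → x ∈ inVars (head C) → x ∉ outVarsQ (body C))

  VariableDisjoint : Query → Clause → Set
  VariableDisjoint Q C = (x : Var) → x ∈ varsQ Q → x ∉ varsC C

  IsMGU : Subst → Atom → Atom → Set
  IsMGU θ A B =
    (A ⟨ θ ⟩ₐ ≡ B ⟨ θ ⟩ₐ) ×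
    ((σ : Subst) → A ⟨ σ ⟩ₐ ≡ B ⟨ σ ⟩ₐ →
      Σ Subst λ δ → (x : Var) → σ x ≡ (θ x) ⟨ δ ⟩)

  SLDResolvent : Query → Clause → Query → Set
  SLDResolvent Q C Q' =
    Σ Query λ Q₁ → Σ Atom λ A → Σ Query λ Q₂ → Σ Subst λ θ →
      (Q ≡ Q₁ ++ (A ∷ Q₂)) × IsMGU θ A (head C) ×
      (Q' ≡ (Q₁ ++ body C ++ Q₂) ⟨ θ ⟩q)

-- Unifying A = p(s;t) with the clause head H = p(u;v) amounts to solving the equations
-- s = u and v = t. Orient them in the direction of the data flow, s = u from the query to
-- the clause and v = t from the clause to the query, and read each as a node with one input
-- and one output. Together with the atoms of Q₁, Q₂ and the body B these nodes form a tidy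
-- data-flow graph: query and clause variables are disjoint, an edge through a query variable
-- is an edge of Q once every equation is identified with A, and clause variables only flow
-- from input positions through B to output positions. Each step of the Martelli–Montanari
-- algorithm (binding the produced or the consumed variable of an equation, decomposing
-- f(cs) = f(ps)) keeps such a graph tidy, so it computes a unifier ψ under which the atoms
-- of the resolvent are tidy. As θ is most general and factors through ψ, it acts on the
-- variables of the ψ-instances as an injective renaming, which preserves tidiness.

module Submission where

open import Defs
open import Data.Empty using (⊥; ⊥-elim)
open import Data.Fin using (Fin; zero; suc; splitAt; _↑ˡ_; _↑ʳ_)
open import Data.Fin.Properties using (suc-injective; 0≢1+n; join-splitAt)
open import Data.List using (List; []; _∷_; _++_; concatMap; length; lookup; map)
open import Data.List.Properties using (++-identityʳ; concatMap-++; map-∘; map-cong; map-id)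
open import Data.List.Membership.Propositional using (_∈_; _∉_; find; lose)
open import Data.List.Membership.Propositional.Properties
  using (∈-++⁺ˡ; ∈-++⁺ʳ; ∈-++⁻; ∈-concatMap⁺; ∈-concatMap⁻)
open import Data.List.Relation.Binary.Disjoint.Propositional using (Disjoint)
open import Data.List.Relation.Unary.All using ([]; _∷_)
open import Data.List.Relation.Unary.AllPairs using ([]; _∷_)
open import Data.List.Relation.Unary.Any using (here; there)
open import Data.List.Relation.Unary.Unique.Propositional using (Unique)
open import Data.Maybe using (Maybe; just; nothing)
open import Data.Maybe.Properties using (just-injective)
open import Data.Nat using (ℕ; suc; _+_; _<_; _≟_; s≤s; z≤n)
open import Data.Nat.Properties using (+-assoc; <-≤-trans; ≤-reflexive; ≤-refl; m<n+m)
open import Data.Product using (Σ; ∃; _×_; _,_; proj₁; proj₂)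
open import Data.Sum using (_⊎_; inj₁; inj₂; [_,_]′)
open import Data.Vec using (Vec; []; _∷_; tabulate) renaming (lookup to lookupᵛ; _++_ to _++ᵛ_)
open import Function using (_∘_)
open import Relation.Binary.Construct.Closure.Transitive using (TransClosure; [_]; _∷_) renaming (_++_ to _++⁺_)
open import Relation.Binary.PropositionalEquality
  using (_≡_; _≢_; refl; sym; trans; cong; cong₂; subst; module ≡-Reasoning)
open import Relation.Nullary using (¬_; Dec; yes; no)
import Data.List.Relation.Unary.All as All
import Data.List.Relation.Unary.Unique.Propositional.Properties as Unique
import Data.Sum as Sum
import Data.Vec.Properties as Vec

-- Lists, indices and acyclic relations

module _ {A : Set} where

  Unique-++⁻ : ∀ xs {ys : List A} → Unique (xs ++ ys) → Unique xs × Unique ys × Disjoint xs ys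
  Unique-++⁻ []       u        = [] , u , λ ()
  Unique-++⁻ (x ∷ xs) (x∉ ∷ u) with Unique-++⁻ xs u
  ... | uxs , uys , xs#ys =
    All.tabulate (λ y∈xs → All.lookup x∉ (∈-++⁺ˡ y∈xs)) ∷ uxs , uys ,
    λ { (here refl , v∈ys)  → All.lookup x∉ (∈-++⁺ʳ xs v∈ys) refl
      ; (there v∈xs , v∈ys) → xs#ys (v∈xs , v∈ys) }

module _ {A B : Set} (f : A → List B) where

  ∈-concatMap-intro : ∀ {xs y z} → y ∈ xs → z ∈ f y → z ∈ concatMap f xs
  ∈-concatMap-intro y∈xs z∈fy = ∈-concatMap⁺ f (lose y∈xs z∈fy)

  ∈-concatMap-elim : ∀ {xs z} → z ∈ concatMap f xs → ∃ λ y → y ∈ xs × z ∈ f y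
  ∈-concatMap-elim z∈ = find (∈-concatMap⁻ f z∈)

  Unique-concatMap⁺ : ∀ {xs} → Unique xs → (∀ {y} → y ∈ xs → Unique (f y)) →
    (∀ {y y′ z} → y ∈ xs → y′ ∈ xs → z ∈ f y → z ∈ f y′ → y ≡ y′) → Unique (concatMap f xs)
  Unique-concatMap⁺ {[]}     []         _      _         = []
  Unique-concatMap⁺ {x ∷ xs} (x∉ ∷ uxs) unique injective =
    Unique.++⁺ (unique (here refl))
      (Unique-concatMap⁺ uxs (unique ∘ there) (λ y∈ y′∈ → injective (there y∈) (there y′∈)))
      λ (z∈fx , z∈rest) → let y , y∈xs , z∈fy = ∈-concatMap-elim z∈rest in
        All.lookup x∉ y∈xs (injective (here refl) (there y∈xs) z∈fx z∈fy)

  ∈-concatMap-lookup : ∀ xs {z} → z ∈ concatMap f xs → ∃ λ i → z ∈ f (lookup xs i)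
  ∈-concatMap-lookup (x ∷ xs) z∈ with ∈-++⁻ (f x) z∈
  ... | inj₁ z∈fx   = zero , z∈fx
  ... | inj₂ z∈rest = let i , z∈fi = ∈-concatMap-lookup xs z∈rest in suc i , z∈fi

  lookup-concatMap⊆ : ∀ xs i {z} → z ∈ f (lookup xs i) → z ∈ concatMap f xs
  lookup-concatMap⊆ (x ∷ xs) zero    z∈ = ∈-++⁺ˡ z∈
  lookup-concatMap⊆ (x ∷ xs) (suc i) z∈ = ∈-++⁺ʳ (f x) (lookup-concatMap⊆ xs i z∈)

  LinearAt : List A → Set
  LinearAt xs = (∀ i → Unique (f (lookup xs i))) ×
                (∀ {i j z} → z ∈ f (lookup xs i) → z ∈ f (lookup xs j) → i ≡ j)

  Unique-concatMap⇒LinearAt : ∀ xs → Unique (concatMap f xs) → LinearAt xs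
  Unique-concatMap⇒LinearAt []       u = (λ ()) , λ { {()} }
  Unique-concatMap⇒LinearAt (x ∷ xs) u with Unique-++⁻ (f x) u
  ... | ux , urest , disjoint with Unique-concatMap⇒LinearAt xs urest
  ... | uxs , injxs = unique , injective
    where
    unique : ∀ i → Unique (f (lookup (x ∷ xs) i))
    unique zero    = ux
    unique (suc i) = uxs i
    injective : ∀ {i j z} → z ∈ f (lookup (x ∷ xs) i) → z ∈ f (lookup (x ∷ xs) j) → i ≡ j
    injective {zero}  {zero}  _  _   = refl
    injective {zero}  {suc j} z∈ z∈′ = ⊥-elim (disjoint (z∈ , lookup-concatMap⊆ xs j z∈′))
    injective {suc i} {zero}  z∈ z∈′ = ⊥-elim (disjoint (z∈′ , lookup-concatMap⊆ xs i z∈))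
    injective {suc i} {suc j} z∈ z∈′ = cong suc (injxs z∈ z∈′)

  LinearAt⇒Unique-concatMap : ∀ xs → LinearAt xs → Unique (concatMap f xs)
  LinearAt⇒Unique-concatMap []       _                    = []
  LinearAt⇒Unique-concatMap (x ∷ xs) (unique , injective) =
    Unique.++⁺ (unique zero)
      (LinearAt⇒Unique-concatMap xs (unique ∘ suc , λ z∈ z∈′ → suc-injective (injective z∈ z∈′)))
      λ (z∈fx , z∈rest) → let i , z∈fi = ∈-concatMap-lookup xs z∈rest in 0≢1+n (injective z∈fx z∈fi)

retraction⇒injective : ∀ {A B : Set} (f : A → B) (g : B → A) → (∀ x → g (f x) ≡ x) →
                       ∀ {x y} → f x ≡ f y → x ≡ y
retraction⇒injective f g gf {x} {y} eq = trans (sym (gf x)) (trans (cong g eq) (gf y))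

lookupᵛ-extensionality : ∀ {A : Set} {n} {xs ys : Vec A n} →
                         (∀ k → lookupᵛ xs k ≡ lookupᵛ ys k) → xs ≡ ys
lookupᵛ-extensionality {xs = xs} {ys} eq =
  trans (sym (Vec.tabulate∘lookup xs)) (trans (Vec.tabulate-cong eq) (Vec.tabulate∘lookup ys))

IsAcyclic : ∀ {I : Set} → (I → I → Set) → Set
IsAcyclic R = ∀ i → ¬ TransClosure R i i

module _ {I J : Set} {R : I → I → Set} {S : J → J → Set} (f : J → I) where

  TransClosure-map : (∀ {i j} → S i j → TransClosure R (f i) (f j)) →
                     ∀ {i j} → TransClosure S i j → TransClosure R (f i) (f j)
  TransClosure-map lift [ s ]    = lift s
  TransClosure-map lift (s ∷ ss) = lift s ++⁺ TransClosure-map lift ss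

  IsAcyclic-map : (∀ {i j} → S i j → TransClosure R (f i) (f j)) → IsAcyclic R → IsAcyclic S
  IsAcyclic-map lift acyclic i cycle = acyclic (f i) (TransClosure-map lift cycle)

module _ {I J : Set} {R : I → I → Set} {S T : J → J → Set} (f : J → I)
         (split : ∀ {i j} → S i j → R (f i) (f j) ⊎ (T i j × f i ≡ f j)) where

  TransClosure-collapse : ∀ {i j} → TransClosure S i j →
                          TransClosure R (f i) (f j) ⊎ (TransClosure T i j × f i ≡ f j)
  TransClosure-collapse [ s ] with split s
  ... | inj₁ r        = inj₁ [ r ]
  ... | inj₂ (t , eq) = inj₂ ([ t ] , eq)
  TransClosure-collapse {i} {j} (s ∷ ss) with split s | TransClosure-collapse ss
  ... | inj₁ r        | inj₁ rs         = inj₁ (r ∷ rs)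
  ... | inj₁ r        | inj₂ (_ , eq)   = inj₁ [ subst (R (f i)) eq r ]
  ... | inj₂ (_ , eq) | inj₁ rs         = inj₁ (subst (λ k → TransClosure R k (f j)) (sym eq) rs)
  ... | inj₂ (t , eq) | inj₂ (ts , eq′) = inj₂ (t ∷ ts , trans eq eq′)

  IsAcyclic-collapse : IsAcyclic R → IsAcyclic T → IsAcyclic S
  IsAcyclic-collapse acyclicR acyclicT i cycle with TransClosure-collapse cycle
  ... | inj₁ rs       = acyclicR (f i) rs
  ... | inj₂ (ts , _) = acyclicT i ts

module _ {X : Set} where

  splitIndex : ∀ (xs : List X) {ys} → Fin (length (xs ++ ys)) → Fin (length xs) ⊎ Fin (length ys)
  splitIndex []       i       = inj₂ i
  splitIndex (x ∷ xs) zero    = inj₁ zero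
  splitIndex (x ∷ xs) (suc i) = Sum.map₁ suc (splitIndex xs i)

  joinIndex : ∀ (xs : List X) {ys} → Fin (length xs) ⊎ Fin (length ys) → Fin (length (xs ++ ys))
  joinIndex []       (inj₂ i)       = i
  joinIndex (x ∷ xs) (inj₁ zero)    = zero
  joinIndex (x ∷ xs) (inj₁ (suc i)) = suc (joinIndex xs (inj₁ i))
  joinIndex (x ∷ xs) (inj₂ i)       = suc (joinIndex xs (inj₂ i))

  splitIndex-joinIndex : ∀ xs {ys} i → splitIndex xs {ys} (joinIndex xs i) ≡ i
  splitIndex-joinIndex []       (inj₂ i)       = refl
  splitIndex-joinIndex (x ∷ xs) (inj₁ zero)    = refl
  splitIndex-joinIndex (x ∷ xs) (inj₁ (suc i)) = cong (Sum.map₁ suc) (splitIndex-joinIndex xs (inj₁ i))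
  splitIndex-joinIndex (x ∷ xs) (inj₂ i)       = cong (Sum.map₁ suc) (splitIndex-joinIndex xs (inj₂ i))

  joinIndex-splitIndex : ∀ xs {ys} i → joinIndex xs {ys} (splitIndex xs i) ≡ i
  joinIndex-splitIndex []       i       = refl
  joinIndex-splitIndex (x ∷ xs) zero    = refl
  joinIndex-splitIndex (x ∷ xs) (suc i) with splitIndex xs i | joinIndex-splitIndex xs i
  ... | inj₁ j | eq = cong suc eq
  ... | inj₂ j | eq = cong suc eq

  lookup-joinIndex : ∀ xs {ys} i → lookup (xs ++ ys) (joinIndex xs i) ≡ [ lookup xs , lookup ys ]′ i
  lookup-joinIndex []       (inj₂ i)       = refl
  lookup-joinIndex (x ∷ xs) (inj₁ zero)    = refl
  lookup-joinIndex (x ∷ xs) (inj₁ (suc i)) = lookup-joinIndex xs (inj₁ i)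
  lookup-joinIndex (x ∷ xs) (inj₂ i)       = lookup-joinIndex xs (inj₂ i)

  joinIndex-injective : ∀ xs {ys} {i j} → joinIndex xs {ys} i ≡ joinIndex xs j → i ≡ j
  joinIndex-injective xs = retraction⇒injective (joinIndex xs) (splitIndex xs) (splitIndex-joinIndex xs)

  lookup-splitIndex : ∀ xs {ys} i → lookup (xs ++ ys) i ≡ [ lookup xs , lookup ys ]′ (splitIndex xs i)
  lookup-splitIndex xs i =
    trans (cong (lookup (xs ++ _)) (sym (joinIndex-splitIndex xs i))) (lookup-joinIndex xs (splitIndex xs i))

_≟ᴹ_ : (m m′ : Mode) → Dec (m ≡ m′)
input  ≟ᴹ input  = yes refl
input  ≟ᴹ output = no λ ()
output ≟ᴹ input  = no λ ()
output ≟ᴹ output = yes refl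

module Tidiness (Sg : Signature) (moding : Moding Sg) where
  open Signature Sg
  open LP Sg moding

  -- Substitutions

  infixl 6 _⊙_
  _⊙_ : Subst → Subst → Subst
  (σ ⊙ τ) x = σ x ⟨ τ ⟩

  mutual
    ⟨⟩-⊙ : ∀ t σ τ → t ⟨ σ ⟩ ⟨ τ ⟩ ≡ t ⟨ σ ⊙ τ ⟩
    ⟨⟩-⊙ (var x)   σ τ = refl
    ⟨⟩-⊙ (fn f ts) σ τ = cong (fn f) (⟨⟩*-⊙ ts σ τ)

    ⟨⟩*-⊙ : ∀ {n} (ts : Vec Term n) σ τ → ts ⟨ σ ⟩* ⟨ τ ⟩* ≡ ts ⟨ σ ⊙ τ ⟩*
    ⟨⟩*-⊙ []       σ τ = refl
    ⟨⟩*-⊙ (t ∷ ts) σ τ = cong₂ _∷_ (⟨⟩-⊙ t σ τ) (⟨⟩*-⊙ ts σ τ)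

  mutual
    ⟨⟩-cong : ∀ t {σ τ} → (∀ {x} → x ∈ vars t → σ x ≡ τ x) → t ⟨ σ ⟩ ≡ t ⟨ τ ⟩
    ⟨⟩-cong (var x)   σ≗τ = σ≗τ (here refl)
    ⟨⟩-cong (fn f ts) σ≗τ = cong (fn f) (⟨⟩*-cong ts σ≗τ)

    ⟨⟩*-cong : ∀ {n} (ts : Vec Term n) {σ τ} → (∀ {x} → x ∈ vars* ts → σ x ≡ τ x) →
               ts ⟨ σ ⟩* ≡ ts ⟨ τ ⟩*
    ⟨⟩*-cong []       σ≗τ = refl
    ⟨⟩*-cong (t ∷ ts) σ≗τ =
      cong₂ _∷_ (⟨⟩-cong t (σ≗τ ∘ ∈-++⁺ˡ)) (⟨⟩*-cong ts (σ≗τ ∘ ∈-++⁺ʳ (vars t)))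

  mutual
    ⟨var⟩ : ∀ t → t ⟨ var ⟩ ≡ t
    ⟨var⟩ (var x)   = refl
    ⟨var⟩ (fn f ts) = cong (fn f) (⟨var⟩* ts)

    ⟨var⟩* : ∀ {n} (ts : Vec Term n) → ts ⟨ var ⟩* ≡ ts
    ⟨var⟩* []       = refl
    ⟨var⟩* (t ∷ ts) = cong₂ _∷_ (⟨var⟩ t) (⟨var⟩* ts)

  mutual
    vars-⟨⟩ : ∀ t σ → vars (t ⟨ σ ⟩) ≡ concatMap (vars ∘ σ) (vars t)
    vars-⟨⟩ (var x)   σ = sym (++-identityʳ (vars (σ x)))
    vars-⟨⟩ (fn f ts) σ = vars*-⟨⟩* ts σ

    vars*-⟨⟩* : ∀ {n} (ts : Vec Term n) σ → vars* (ts ⟨ σ ⟩*) ≡ concatMap (vars ∘ σ) (vars* ts)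
    vars*-⟨⟩* []       σ = refl
    vars*-⟨⟩* (t ∷ ts) σ = trans (cong₂ _++_ (vars-⟨⟩ t σ) (vars*-⟨⟩* ts σ))
                                 (sym (concatMap-++ (vars ∘ σ) (vars t) (vars* ts)))

  mutual
    ⟨⟩-fixed⇒var : ∀ t {σ x} → t ⟨ σ ⟩ ≡ t → x ∈ vars t → σ x ≡ var x
    ⟨⟩-fixed⇒var (var y)   eq (here refl) = eq
    ⟨⟩-fixed⇒var (fn f ts) eq x∈          = ⟨⟩*-fixed⇒var ts (fn-injective eq) x∈
      where
      fn-injective : ∀ {us vs : Vec Term (fun-arity f)} → fn f us ≡ fn f vs → us ≡ vs
      fn-injective refl = refl

    ⟨⟩*-fixed⇒var : ∀ {n} (ts : Vec Term n) {σ x} → ts ⟨ σ ⟩* ≡ ts → x ∈ vars* ts → σ x ≡ var x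
    ⟨⟩*-fixed⇒var (t ∷ ts) eq x∈ with ∈-++⁻ (vars t) x∈
    ... | inj₁ x∈t  = ⟨⟩-fixed⇒var t (Vec.∷-injectiveˡ eq) x∈t
    ... | inj₂ x∈ts = ⟨⟩*-fixed⇒var ts (Vec.∷-injectiveʳ eq) x∈ts

  mutual
    size : Term → ℕ
    size (var x)   = 1
    size (fn f ts) = suc (size* ts)

    size* : ∀ {n} → Vec Term n → ℕ
    size* []       = 0
    size* (t ∷ ts) = size t + size* ts

  size-positive : ∀ t → 0 < size t
  size-positive (var x)   = s≤s z≤n
  size-positive (fn f ts) = s≤s z≤n

  size*-++ : ∀ {m n} (ts : Vec Term m) (us : Vec Term n) → size* (ts ++ᵛ us) ≡ size* ts + size* us
  size*-++ []       us = refl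
  size*-++ (t ∷ ts) us = trans (cong (size t +_) (size*-++ ts us)) (sym (+-assoc (size t) _ _))

  ⟨⟩*-++ : ∀ {m n} (ts : Vec Term m) (us : Vec Term n) σ →
           (ts ++ᵛ us) ⟨ σ ⟩* ≡ ts ⟨ σ ⟩* ++ᵛ us ⟨ σ ⟩*
  ⟨⟩*-++ []       us σ = refl
  ⟨⟩*-++ (t ∷ ts) us σ = cong (t ⟨ σ ⟩ ∷_) (⟨⟩*-++ ts us σ)

  lookup-⟨⟩* : ∀ {n} (ts : Vec Term n) σ k → lookupᵛ (ts ⟨ σ ⟩*) k ≡ lookupᵛ ts k ⟨ σ ⟩
  lookup-⟨⟩* (t ∷ ts) σ zero    = refl
  lookup-⟨⟩* (t ∷ ts) σ (suc k) = lookup-⟨⟩* ts σ k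

  _↦_ : Var → Term → Subst
  (x ↦ t) y with y ≟ x
  ... | yes _ = t
  ... | no  _ = var y

  ↦-self : ∀ x t → (x ↦ t) x ≡ t
  ↦-self x t with x ≟ x
  ... | yes _  = refl
  ... | no x≢x = ⊥-elim (x≢x refl)

  ↦-other : ∀ {x y} t → y ≢ x → (x ↦ t) y ≡ var y
  ↦-other {x} {y} t y≢x with y ≟ x
  ... | yes y≡x = ⊥-elim (y≢x y≡x)
  ... | no  _   = refl

  ↦-cases : ∀ x t y → (y ≡ x × (x ↦ t) y ≡ t) ⊎ (y ≢ x × (x ↦ t) y ≡ var y)
  ↦-cases x t y with y ≟ x
  ... | yes y≡x = inj₁ (y≡x , refl)
  ... | no  y≢x = inj₂ (y≢x , refl)

  ∈-vars-var : ∀ {t y z} → t ≡ var y → z ∈ vars t → z ≡ y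
  ∈-vars-var refl (here z≡y) = z≡y

  Unique-vars-var : ∀ {t y} → t ≡ var y → Unique (vars t)
  Unique-vars-var refl = [] ∷ []

  ∈-vars-↦ : ∀ x t y {z} → z ∈ vars ((x ↦ t) y) → (y ≡ x × z ∈ vars t) ⊎ (y ≢ x × z ≡ y)
  ∈-vars-↦ x t y z∈ with ↦-cases x t y
  ... | inj₁ (y≡x , eq) = inj₁ (y≡x , subst (λ u → _ ∈ vars u) eq z∈)
  ... | inj₂ (y≢x , eq) = inj₂ (y≢x , ∈-vars-var eq z∈)

  ⟨↦⟩-∉ : ∀ {x} t u → x ∉ vars u → u ⟨ x ↦ t ⟩ ≡ u
  ⟨↦⟩-∉ {x} t u x∉ = trans (⟨⟩-cong u fixes) (⟨var⟩ u)
    where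
    fixes : ∀ {y} → y ∈ vars u → (x ↦ t) y ≡ var y
    fixes {y} y∈ = ↦-other t λ { refl → x∉ y∈ }

  ↦-⊙-absorb : ∀ {x t θ} → θ x ≡ t ⟨ θ ⟩ → ∀ y → ((x ↦ t) ⊙ θ) y ≡ θ y
  ↦-⊙-absorb {x} {t} eq y with y ≟ x
  ... | yes refl = sym eq
  ... | no  _    = refl

  -- Arguments selected by a mode

  varsᴸ : List Term → List Var
  varsᴸ = concatMap vars

  varsᴸ-⟨⟩ : ∀ ts σ → varsᴸ (map (_⟨ σ ⟩) ts) ≡ concatMap (vars ∘ σ) (varsᴸ ts)
  varsᴸ-⟨⟩ []       σ = refl
  varsᴸ-⟨⟩ (t ∷ ts) σ = trans (cong₂ _++_ (vars-⟨⟩ t σ) (varsᴸ-⟨⟩ ts σ))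
                              (sym (concatMap-++ (vars ∘ σ) (vars t) (varsᴸ ts)))

  select-here : ∀ {n} (md : Fin (suc n) → Mode) m {t} {ts : Vec Term n} →
                md zero ≡ m → select md m (t ∷ ts) ≡ t ∷ select (md ∘ suc) m ts
  select-here md input  eq with md zero
  select-here md input  refl | input  = refl
  select-here md output eq with md zero
  select-here md output refl | output = refl

  select-skip : ∀ {n} (md : Fin (suc n) → Mode) m {t} {ts : Vec Term n} →
                md zero ≢ m → select md m (t ∷ ts) ≡ select (md ∘ suc) m ts
  select-skip md input  neq with md zero
  ... | input  = ⊥-elim (neq refl)
  ... | output = refl
  select-skip md output neq with md zero
  ... | input  = refl
  ... | output = ⊥-elim (neq refl)

  module _ {n} (md : Fin (suc n) → Mode) (m : Mode) {t : Term} {ts : Vec Term n} where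

    varsᴸ-select-here : md zero ≡ m → varsᴸ (select md m (t ∷ ts)) ≡ vars t ++ varsᴸ (select (md ∘ suc) m ts)
    varsᴸ-select-here eq = cong varsᴸ (select-here md m eq)

    varsᴸ-select-skip : md zero ≢ m → varsᴸ (select md m (t ∷ ts)) ≡ varsᴸ (select (md ∘ suc) m ts)
    varsᴸ-select-skip neq = cong varsᴸ (select-skip md m neq)

  select-⟨⟩ : ∀ {n} (md : Fin n → Mode) m (ts : Vec Term n) σ →
              select md m (ts ⟨ σ ⟩*) ≡ map (_⟨ σ ⟩) (select md m ts)
  select-⟨⟩ md m []       σ = refl
  select-⟨⟩ md m (t ∷ ts) σ with md zero ≟ᴹ m
  ... | yes eq = trans (select-here md m eq)
                   (trans (cong (t ⟨ σ ⟩ ∷_) (select-⟨⟩ (md ∘ suc) m ts σ))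
                          (cong (map (_⟨ σ ⟩)) (sym (select-here md m eq))))
  ... | no neq = trans (select-skip md m neq)
                   (trans (select-⟨⟩ (md ∘ suc) m ts σ)
                          (cong (map (_⟨ σ ⟩)) (sym (select-skip md m neq))))

  varsᴸ-select⊆vars* : ∀ {n} (md : Fin n → Mode) m (ts : Vec Term n) {x} →
                       x ∈ varsᴸ (select md m ts) → x ∈ vars* ts
  varsᴸ-select⊆vars* md m (t ∷ ts) x∈ with md zero ≟ᴹ m
  ... | no neq =
    ∈-++⁺ʳ (vars t) (varsᴸ-select⊆vars* (md ∘ suc) m ts (subst (_ ∈_) (varsᴸ-select-skip md m neq) x∈))
  ... | yes eq with ∈-++⁻ (vars t) (subst (_ ∈_) (varsᴸ-select-here md m eq) x∈)
  ...   | inj₁ x∈t    = ∈-++⁺ˡ x∈t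
  ...   | inj₂ x∈rest = ∈-++⁺ʳ (vars t) (varsᴸ-select⊆vars* (md ∘ suc) m ts x∈rest)

  vars-lookup⊆select : ∀ {n} (md : Fin n → Mode) m (ts : Vec Term n) k {x} →
                       md k ≡ m → x ∈ vars (lookupᵛ ts k) → x ∈ varsᴸ (select md m ts)
  vars-lookup⊆select md m (t ∷ ts) zero eq x∈ = subst (_ ∈_) (sym (varsᴸ-select-here md m eq)) (∈-++⁺ˡ x∈)
  vars-lookup⊆select md m (t ∷ ts) (suc k) eq x∈ with md zero ≟ᴹ m
  ... | yes eq₀ = subst (_ ∈_) (sym (varsᴸ-select-here md m eq₀))
                    (∈-++⁺ʳ (vars t) (vars-lookup⊆select (md ∘ suc) m ts k eq x∈))
  ... | no neq₀ = subst (_ ∈_) (sym (varsᴸ-select-skip md m neq₀)) (vars-lookup⊆select (md ∘ suc) m ts k eq x∈)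

  Unique-select-lookup : ∀ {n} (md : Fin n → Mode) m (ts : Vec Term n) k →
                         md k ≡ m → Unique (varsᴸ (select md m ts)) → Unique (vars (lookupᵛ ts k))
  Unique-select-lookup md m (t ∷ ts) zero eq u =
    proj₁ (Unique-++⁻ (vars t) (subst Unique (varsᴸ-select-here md m eq) u))
  Unique-select-lookup md m (t ∷ ts) (suc k) eq u with md zero ≟ᴹ m
  ... | yes eq₀ = Unique-select-lookup (md ∘ suc) m ts k eq
                    (proj₁ (proj₂ (Unique-++⁻ (vars t) (subst Unique (varsᴸ-select-here md m eq₀) u))))
  ... | no neq₀ = Unique-select-lookup (md ∘ suc) m ts k eq (subst Unique (varsᴸ-select-skip md m neq₀) u)

  select-lookup-injective : ∀ {n} (md : Fin n → Mode) m (ts : Vec Term n) {k k′ x} →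
    md k ≡ m → md k′ ≡ m → Unique (varsᴸ (select md m ts)) →
    x ∈ vars (lookupᵛ ts k) → x ∈ vars (lookupᵛ ts k′) → k ≡ k′
  select-lookup-injective md m (t ∷ ts) {zero} {zero} _ _ _ _ _ = refl
  select-lookup-injective md m (t ∷ ts) {zero} {suc k′} eq eq′ u x∈ x∈′ =
    ⊥-elim (proj₂ (proj₂ (Unique-++⁻ (vars t) (subst Unique (varsᴸ-select-here md m eq) u)))
             (x∈ , vars-lookup⊆select (md ∘ suc) m ts k′ eq′ x∈′))
  select-lookup-injective md m (t ∷ ts) {suc k} {zero} eq eq′ u x∈ x∈′ =
    ⊥-elim (proj₂ (proj₂ (Unique-++⁻ (vars t) (subst Unique (varsᴸ-select-here md m eq′) u)))
             (x∈′ , vars-lookup⊆select (md ∘ suc) m ts k eq x∈))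
  select-lookup-injective md m (t ∷ ts) {suc k} {suc k′} eq eq′ u x∈ x∈′ with md zero ≟ᴹ m
  ... | yes eq₀ = cong suc (select-lookup-injective (md ∘ suc) m ts eq eq′
                    (proj₁ (proj₂ (Unique-++⁻ (vars t) (subst Unique (varsᴸ-select-here md m eq₀) u)))) x∈ x∈′)
  ... | no neq₀ = cong suc (select-lookup-injective (md ∘ suc) m ts eq eq′
                    (subst Unique (varsᴸ-select-skip md m neq₀) u) x∈ x∈′)

  -- Under a constant moding every argument is selected, so the lemmas above cover all arguments.
  varsᴸ-select-all : ∀ {n} m (ts : Vec Term n) → varsᴸ (select (λ _ → m) m ts) ≡ vars* ts
  varsᴸ-select-all m []       = refl
  varsᴸ-select-all m (t ∷ ts) =
    trans (varsᴸ-select-here (λ _ → m) m refl) (cong (vars t ++_) (varsᴸ-select-all m ts))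

  vars-lookup⊆vars* : ∀ {n} (ts : Vec Term n) k {x} → x ∈ vars (lookupᵛ ts k) → x ∈ vars* ts
  vars-lookup⊆vars* ts k x∈ =
    subst (_ ∈_) (varsᴸ-select-all input ts) (vars-lookup⊆select (λ _ → input) input ts k refl x∈)

  Unique-vars*-lookup : ∀ {n} (ts : Vec Term n) k → Unique (vars* ts) → Unique (vars (lookupᵛ ts k))
  Unique-vars*-lookup ts k u =
    Unique-select-lookup (λ _ → input) input ts k refl (subst Unique (sym (varsᴸ-select-all input ts)) u)

  vars*-lookup-injective : ∀ {n} (ts : Vec Term n) {k k′ x} → Unique (vars* ts) →
                           x ∈ vars (lookupᵛ ts k) → x ∈ vars (lookupᵛ ts k′) → k ≡ k′
  vars*-lookup-injective ts u =
    select-lookup-injective (λ _ → input) input ts refl refl (subst Unique (sym (varsᴸ-select-all input ts)) u)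

  -- Data-flow graphs

  record Node : Set where
    constructor _⇒_
    field
      inputs outputs : List Term
  open Node

  inVarsᴺ outVarsᴺ : Node → List Var
  inVarsᴺ  = varsᴸ ∘ inputs
  outVarsᴺ = varsᴸ ∘ outputs

  infix 4 _∈ᴺ_
  _∈ᴺ_ : Var → Node → Set
  y ∈ᴺ N = y ∈ inVarsᴺ N ⊎ y ∈ outVarsᴺ N

  node : Atom → Node
  node A = inTerms A ⇒ outTerms A

  _≐_ : Term → Term → Node
  s ≐ t = (s ∷ []) ⇒ (t ∷ [])

  inVars-≐ : ∀ s t → inVarsᴺ (s ≐ t) ≡ vars s
  inVars-≐ s t = ++-identityʳ (vars s)

  outVars-≐ : ∀ s t → outVarsᴺ (s ≐ t) ≡ vars t
  outVars-≐ s t = ++-identityʳ (vars t)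

  _⟪_⟫ : Node → Subst → Node
  (ins ⇒ outs) ⟪ σ ⟫ = map (_⟨ σ ⟩) ins ⇒ map (_⟨ σ ⟩) outs

  ⟪⟫-⊙ : ∀ N σ τ → N ⟪ σ ⟫ ⟪ τ ⟫ ≡ N ⟪ σ ⊙ τ ⟫
  ⟪⟫-⊙ (ins ⇒ outs) σ τ = cong₂ _⇒_ (map-⊙ ins) (map-⊙ outs)
    where
    map-⊙ : ∀ ts → map (_⟨ τ ⟩) (map (_⟨ σ ⟩) ts) ≡ map (_⟨ σ ⊙ τ ⟩) ts
    map-⊙ ts = trans (sym (map-∘ ts)) (map-cong (λ t → ⟨⟩-⊙ t σ τ) ts)

  ⟪⟫-cong : ∀ N {σ τ} → (∀ x → σ x ≡ τ x) → N ⟪ σ ⟫ ≡ N ⟪ τ ⟫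
  ⟪⟫-cong (ins ⇒ outs) σ≗τ = cong₂ _⇒_ (map-cong (λ t → ⟨⟩-cong t (λ _ → σ≗τ _)) ins)
                                        (map-cong (λ t → ⟨⟩-cong t (λ _ → σ≗τ _)) outs)

  ⟪var⟫ : ∀ N → N ⟪ var ⟫ ≡ N
  ⟪var⟫ (ins ⇒ outs) = cong₂ _⇒_ (trans (map-cong ⟨var⟩ ins) (map-id ins))
                                  (trans (map-cong ⟨var⟩ outs) (map-id outs))

  node-⟨⟩ : ∀ A σ → node (A ⟨ σ ⟩ₐ) ≡ node A ⟪ σ ⟫
  node-⟨⟩ (atom p ts) σ = cong₂ _⇒_ (select-⟨⟩ (moding p) input ts σ) (select-⟨⟩ (moding p) output ts σ)

  ∈-inVars-⟪⟫⁻ : ∀ N σ {z} → z ∈ inVarsᴺ (N ⟪ σ ⟫) → ∃ λ y → y ∈ inVarsᴺ N × z ∈ vars (σ y)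
  ∈-inVars-⟪⟫⁻ N σ z∈ = ∈-concatMap-elim (vars ∘ σ) (subst (_ ∈_) (varsᴸ-⟨⟩ (inputs N) σ) z∈)

  ∈-outVars-⟪⟫⁻ : ∀ N σ {z} → z ∈ outVarsᴺ (N ⟪ σ ⟫) → ∃ λ y → y ∈ outVarsᴺ N × z ∈ vars (σ y)
  ∈-outVars-⟪⟫⁻ N σ z∈ = ∈-concatMap-elim (vars ∘ σ) (subst (_ ∈_) (varsᴸ-⟨⟩ (outputs N) σ) z∈)

  module _ {I : Set} (R : I → Node) where

    Arrowᶠ : I → I → Set
    Arrowᶠ i j = ∃ λ x → x ∈ outVarsᴺ (R i) × x ∈ inVarsᴺ (R j)

    record OutputLinearᶠ : Set where
      field
        linear   : ∀ i → Unique (outVarsᴺ (R i))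
        disjoint : ∀ {i j x} → x ∈ outVarsᴺ (R i) → x ∈ outVarsᴺ (R j) → i ≡ j

    record Tidyᶠ : Set where
      field
        outputLinear : OutputLinearᶠ
        acyclic      : IsAcyclic Arrowᶠ
      open OutputLinearᶠ outputLinear public

  module _ {I I′ : Set} {R : I → Node} {R′ : I′ → Node} (h : I′ → I) where

    Tidyᶠ-refine :
      (∀ i {x} → x ∈ inVarsᴺ (R′ i) → x ∈ inVarsᴺ (R (h i))) →
      (∀ i {x} → x ∈ outVarsᴺ (R′ i) → x ∈ outVarsᴺ (R (h i))) →
      (∀ i → Unique (outVarsᴺ (R′ i))) →
      (∀ {i j x} → h i ≡ h j → x ∈ outVarsᴺ (R′ i) → x ∈ outVarsᴺ (R′ j) → i ≡ j) →
      Tidyᶠ R → Tidyᶠ R′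
    Tidyᶠ-refine in⊆ out⊆ linear′ fibre T = record
      { outputLinear = record
          { linear   = linear′
          ; disjoint = λ x∈ x∈′ → fibre (disjoint (out⊆ _ x∈) (out⊆ _ x∈′)) x∈ x∈′ }
      ; acyclic = IsAcyclic-map h (λ (x , x∈ , x∈′) → [ x , out⊆ _ x∈ , in⊆ _ x∈′ ]) acyclic }
      where open Tidyᶠ T

    Tidyᶠ-reindex : (∀ {i j} → h i ≡ h j → i ≡ j) → (∀ i → R′ i ≡ R (h i)) → Tidyᶠ R → Tidyᶠ R′
    Tidyᶠ-reindex injective eq T = Tidyᶠ-refine
      (λ i → subst (λ N → _ ∈ inVarsᴺ N) (eq i))
      (λ i → subst (λ N → _ ∈ outVarsᴺ N) (eq i))
      (λ i → subst (Unique ∘ outVarsᴺ) (sym (eq i)) (Tidyᶠ.linear T (h i)))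
      (λ hi≡hj _ _ → injective hi≡hj) T

  Tidyᶠ-cong : ∀ {I} {R R′ : I → Node} → (∀ i → R′ i ≡ R i) → Tidyᶠ R → Tidyᶠ R′
  Tidyᶠ-cong = Tidyᶠ-reindex (λ i → i) (λ eq → eq)

  OutputLinearᶠ-⟪⟫ : ∀ {I} {R : I → Node} σ → OutputLinearᶠ R →
    (∀ {i y} → y ∈ outVarsᴺ (R i) → Unique (vars (σ y))) →
    (∀ {i j y y′ z} → y ∈ outVarsᴺ (R i) → y′ ∈ outVarsᴺ (R j) →
                      z ∈ vars (σ y) → z ∈ vars (σ y′) → y ≡ y′) →
    OutputLinearᶠ (λ i → R i ⟪ σ ⟫)
  OutputLinearᶠ-⟪⟫ {R = R} σ OL unique injective = record
    { linear   = λ i → subst Unique (sym (varsᴸ-⟨⟩ (outputs (R i)) σ))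
                   (Unique-concatMap⁺ (vars ∘ σ) (linear i) (unique {i}) injective)
    ; disjoint = λ {i} {j} z∈ z∈′ →
        let y  , y∈  , z∈σy  = ∈-outVars-⟪⟫⁻ (R i) σ z∈
            y′ , y′∈ , z∈σy′ = ∈-outVars-⟪⟫⁻ (R j) σ z∈′
        in disjoint y∈ (subst (_∈ outVarsᴺ (R j)) (sym (injective y∈ y′∈ z∈σy z∈σy′)) y′∈) }
    where open OutputLinearᶠ OL

  Tidyᶠ-outputs∉inputs : ∀ {I} {R : I → Node} → Tidyᶠ R →
                         ∀ i {x} → x ∈ outVarsᴺ (R i) → x ∉ inVarsᴺ (R i)
  Tidyᶠ-outputs∉inputs T i x∈out x∈in = Tidyᶠ.acyclic T i [ _ , x∈out , x∈in ]

  _◃_ : ∀ {I : Set} → Node → (I → Node) → Maybe I → Node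
  (e ◃ R) nothing  = e
  (e ◃ R) (just i) = R i

  module _ {I : Set} {e : Node} {R : I → Node} (T : Tidyᶠ (e ◃ R)) where
    open Tidyᶠ T

    OutputLinearᶠ-◃ : OutputLinearᶠ R
    OutputLinearᶠ-◃ = record
      { linear = linear ∘ just ; disjoint = λ x∈ x∈′ → just-injective (disjoint x∈ x∈′) }

    outputs-◃-disjoint : ∀ {i x} → x ∈ outVarsᴺ (R i) → x ∉ outVarsᴺ e
    outputs-◃-disjoint {i} x∈ x∈e with disjoint {just i} {nothing} x∈ x∈e
    ... | ()

  module _ {I : Set} {R : I → Node} where

    Tidyᶠ-eliminate-output : ∀ c X → Tidyᶠ ((c ≐ var X) ◃ R) → Tidyᶠ (λ i → R i ⟪ X ↦ c ⟫)
    Tidyᶠ-eliminate-output c X T = record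
      { outputLinear = OutputLinearᶠ-⟪⟫ σ (OutputLinearᶠ-◃ T)
                         (λ y∈ → Unique-vars-var (σ-output y∈))
                         (λ y∈ y′∈ z∈ z∈′ → trans (sym (∈-vars-var (σ-output y∈) z∈))
                                                  (∈-vars-var (σ-output y′∈) z∈′))
      ; acyclic = IsAcyclic-map just lift (Tidyᶠ.acyclic T) }
      where
      σ : Subst
      σ = X ↦ c
      σ-output : ∀ {i y} → y ∈ outVarsᴺ (R i) → σ y ≡ var y
      σ-output y∈ = ↦-other c λ { refl → outputs-◃-disjoint T y∈ (here refl) }
      lift : ∀ {i j} → Arrowᶠ (λ i → R i ⟪ σ ⟫) i j →
             TransClosure (Arrowᶠ ((c ≐ var X) ◃ R)) (just i) (just j)
      lift {i} {j} (z , z∈out , z∈in) with ∈-outVars-⟪⟫⁻ (R i) σ z∈out | ∈-inVars-⟪⟫⁻ (R j) σ z∈in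
      ... | y , y∈ , z∈σy | y′ , y′∈ , z∈σy′ with ∈-vars-var (σ-output y∈) z∈σy | ∈-vars-↦ X c y′ z∈σy′
      ...   | refl | inj₁ (refl , z∈c) = _∷_ {y = nothing} (z , y∈ , ∈-++⁺ˡ z∈c) [ X , here refl , y′∈ ]
      ...   | refl | inj₂ (_ , refl)   = [ z , y∈ , y′∈ ]

    Tidyᶠ-eliminate-input : ∀ V p → Tidyᶠ ((var V ≐ p) ◃ R) → Tidyᶠ (λ i → R i ⟪ V ↦ p ⟫)
    Tidyᶠ-eliminate-input V p T = record
      { outputLinear = OutputLinearᶠ-⟪⟫ σ (OutputLinearᶠ-◃ T) unique injective
      ; acyclic      = IsAcyclic-map just lift (Tidyᶠ.acyclic T) }
      where
      σ : Subst
      σ = V ↦ p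
      p-linear : Unique (vars p)
      p-linear = subst Unique (outVars-≐ (var V) p) (Tidyᶠ.linear T nothing)
      fresh : ∀ {i z} → z ∈ outVarsᴺ (R i) → z ∉ vars p
      fresh z∈ z∈p = outputs-◃-disjoint T z∈ (∈-++⁺ˡ z∈p)
      unique : ∀ {i y} → y ∈ outVarsᴺ (R i) → Unique (vars (σ y))
      unique {y = y} _ with ↦-cases V p y
      ... | inj₁ (_ , σy≡p) = subst (Unique ∘ vars) (sym σy≡p) p-linear
      ... | inj₂ (_ , σy≡y) = Unique-vars-var σy≡y
      injective : ∀ {i j y y′ z} → y ∈ outVarsᴺ (R i) → y′ ∈ outVarsᴺ (R j) →
                  z ∈ vars (σ y) → z ∈ vars (σ y′) → y ≡ y′
      injective {y = y} {y′} y∈ y′∈ z∈ z∈′ with ∈-vars-↦ V p y z∈ | ∈-vars-↦ V p y′ z∈′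
      ... | inj₁ (refl , _)   | inj₁ (refl , _)   = refl
      ... | inj₁ (_ , z∈p)    | inj₂ (_ , refl)   = ⊥-elim (fresh y′∈ z∈p)
      ... | inj₂ (_ , refl)   | inj₁ (_ , z∈p)    = ⊥-elim (fresh y∈ z∈p)
      ... | inj₂ (_ , refl)   | inj₂ (_ , refl)   = refl
      lift : ∀ {i j} → Arrowᶠ (λ i → R i ⟪ σ ⟫) i j →
             TransClosure (Arrowᶠ ((var V ≐ p) ◃ R)) (just i) (just j)
      lift {i} {j} (z , z∈out , z∈in) with ∈-outVars-⟪⟫⁻ (R i) σ z∈out | ∈-inVars-⟪⟫⁻ (R j) σ z∈in
      ... | y , y∈ , z∈σy | y′ , y′∈ , z∈σy′ with ∈-vars-↦ V p y z∈σy | ∈-vars-↦ V p y′ z∈σy′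
      ...   | inj₁ (refl , _)   | inj₁ (refl , _)   = [ V , y∈ , y′∈ ]
      ...   | inj₁ (refl , z∈p) | inj₂ (_ , refl)   =
        _∷_ {y = nothing} (V , y∈ , here refl) [ z , ∈-++⁺ˡ z∈p , y′∈ ]
      ...   | inj₂ (_ , refl)   | inj₁ (_ , z∈p)    = ⊥-elim (fresh y∈ z∈p)
      ...   | inj₂ (_ , refl)   | inj₂ (_ , refl)   = [ z , y∈ , y′∈ ]

  equations : ∀ {m} → Vec Term m → Vec Term m → Fin m → Node
  equations ls rs k = lookupᵛ ls k ≐ lookupᵛ rs k

  Tidyᶠ-decompose : ∀ {I} {R : I → Node} f (cs ps : Vec Term (fun-arity f)) →
                    Tidyᶠ ((fn f cs ≐ fn f ps) ◃ R) → Tidyᶠ [ R , equations cs ps ]′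
  Tidyᶠ-decompose {I} {R} f cs ps T = Tidyᶠ-refine h in⊆ out⊆ unique fibre T
    where
    h : I ⊎ Fin (fun-arity f) → Maybe I
    h = [ just , (λ _ → nothing) ]′
    ps-linear : Unique (vars* ps)
    ps-linear = subst Unique (outVars-≐ (fn f cs) (fn f ps)) (Tidyᶠ.linear T nothing)
    in⊆ : ∀ i {x} → x ∈ inVarsᴺ ([ R , equations cs ps ]′ i) →
                    x ∈ inVarsᴺ (((fn f cs ≐ fn f ps) ◃ R) (h i))
    in⊆ (inj₁ i) x∈ = x∈
    in⊆ (inj₂ k) x∈ =
      ∈-++⁺ˡ (vars-lookup⊆vars* cs k (subst (_ ∈_) (inVars-≐ (lookupᵛ cs k) (lookupᵛ ps k)) x∈))
    out⊆ : ∀ i {x} → x ∈ outVarsᴺ ([ R , equations cs ps ]′ i) →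
                     x ∈ outVarsᴺ (((fn f cs ≐ fn f ps) ◃ R) (h i))
    out⊆ (inj₁ i) x∈ = x∈
    out⊆ (inj₂ k) x∈ =
      ∈-++⁺ˡ (vars-lookup⊆vars* ps k (subst (_ ∈_) (outVars-≐ (lookupᵛ cs k) (lookupᵛ ps k)) x∈))
    unique : ∀ i → Unique (outVarsᴺ ([ R , equations cs ps ]′ i))
    unique (inj₁ i) = Tidyᶠ.linear T (just i)
    unique (inj₂ k) =
      subst Unique (sym (outVars-≐ (lookupᵛ cs k) (lookupᵛ ps k))) (Unique-vars*-lookup ps k ps-linear)
    fibre : ∀ {i j x} → h i ≡ h j → x ∈ outVarsᴺ ([ R , equations cs ps ]′ i) →
            x ∈ outVarsᴺ ([ R , equations cs ps ]′ j) → i ≡ j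
    fibre {inj₁ i} {inj₁ j} refl _  _   = refl
    fibre {inj₂ k} {inj₂ k′} _  x∈ x∈′ =
      cong inj₂ (vars*-lookup-injective ps ps-linear (subst (_ ∈_) (outVars-≐ (lookupᵛ cs k) (lookupᵛ ps k)) x∈)
                                                     (subst (_ ∈_) (outVars-≐ (lookupᵛ cs k′) (lookupᵛ ps k′)) x∈′))

  Tidyᶠ-rename : ∀ {I} {R : I → Node} σ δ →
    (∀ {i y} → y ∈ᴺ R i → σ y ⟨ δ ⟩ ≡ var y) →
    Tidyᶠ R → Tidyᶠ (λ i → R i ⟪ σ ⟫)
  Tidyᶠ-rename {R = R} σ δ inverse T = record
    { outputLinear = OutputLinearᶠ-⟪⟫ σ (Tidyᶠ.outputLinear T) unique
                       (λ y∈ y′∈ → same (inj₂ y∈) (inj₂ y′∈))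
    ; acyclic      = IsAcyclic-map (λ i → i) lift (Tidyᶠ.acyclic T) }
    where
    renamed : ∀ {i y} → y ∈ᴺ R i → ∃ λ w → σ y ≡ var w × δ w ≡ var y
    renamed {y = y} y∈ with σ y | inverse y∈
    ... | var w | δw≡y = w , refl , δw≡y
    unique : ∀ {i y} → y ∈ outVarsᴺ (R i) → Unique (vars (σ y))
    unique y∈ = let _ , σy≡w , _ = renamed (inj₂ y∈) in Unique-vars-var σy≡w
    same : ∀ {i j y y′ z} → y ∈ᴺ R i → y′ ∈ᴺ R j →
           z ∈ vars (σ y) → z ∈ vars (σ y′) → y ≡ y′
    same y∈ y′∈ z∈ z∈′ with renamed y∈ | renamed y′∈
    ... | w , σy≡w , δw≡y | w′ , σy′≡w′ , δw′≡y′ with ∈-vars-var σy≡w z∈ | ∈-vars-var σy′≡w′ z∈′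
    ... | refl | refl = var-injective (trans (sym δw≡y) δw′≡y′)
      where
      var-injective : ∀ {x y} → var x ≡ var y → x ≡ y
      var-injective refl = refl
    lift : ∀ {i j} → Arrowᶠ (λ i → R i ⟪ σ ⟫) i j → TransClosure (Arrowᶠ R) i j
    lift {i} {j} (z , z∈out , z∈in) with ∈-outVars-⟪⟫⁻ (R i) σ z∈out | ∈-inVars-⟪⟫⁻ (R j) σ z∈in
    ... | y , y∈ , z∈σy | y′ , y′∈ , z∈σy′ with same (inj₂ y∈) (inj₁ y′∈) z∈σy z∈σy′
    ... | refl = [ y , y∈ , y′∈ ]

  Tidyᶠ-query : ∀ Q → TidyQuery Q → Tidyᶠ (node ∘ lookup Q)
  Tidyᶠ-query Q (outputLinear , acyclic) = record
    { outputLinear = record { linear = proj₁ linearAt ; disjoint = proj₂ linearAt } ; acyclic = acyclic }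
    where linearAt = Unique-concatMap⇒LinearAt outVars Q outputLinear

  TidyQuery-family : ∀ Q → Tidyᶠ (node ∘ lookup Q) → TidyQuery Q
  TidyQuery-family Q T = LinearAt⇒Unique-concatMap outVars Q (linear , disjoint) , acyclic
    where open Tidyᶠ T

  ⟨⟩q-index : ∀ L σ → Fin (length (L ⟨ σ ⟩q)) → Fin (length L)
  ⟨⟩q-index (A ∷ L) σ zero    = zero
  ⟨⟩q-index (A ∷ L) σ (suc i) = suc (⟨⟩q-index L σ i)

  lookup-⟨⟩q : ∀ L σ i → lookup (L ⟨ σ ⟩q) i ≡ lookup L (⟨⟩q-index L σ i) ⟨ σ ⟩ₐ
  lookup-⟨⟩q (A ∷ L) σ zero    = refl
  lookup-⟨⟩q (A ∷ L) σ (suc i) = lookup-⟨⟩q L σ i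

  ⟨⟩q-index-injective : ∀ L σ {i j} → ⟨⟩q-index L σ i ≡ ⟨⟩q-index L σ j → i ≡ j
  ⟨⟩q-index-injective (A ∷ L) σ {zero}  {zero}  _  = refl
  ⟨⟩q-index-injective (A ∷ L) σ {suc i} {suc j} eq = cong suc (⟨⟩q-index-injective L σ (suc-injective eq))

  -- Unification preserves tidiness

  Unifies : ∀ {m} → Subst → Vec Term m → Vec Term m → Set
  Unifies σ ls rs = ls ⟨ σ ⟩* ≡ rs ⟨ σ ⟩*

  Unifies-cong : ∀ {m σ τ} {ls rs : Vec Term m} → (∀ x → σ x ≡ τ x) → Unifies σ ls rs → Unifies τ ls rs
  Unifies-cong {ls = ls} {rs} σ≗τ u =
    trans (⟨⟩*-cong ls (λ _ → sym (σ≗τ _))) (trans u (⟨⟩*-cong rs (λ _ → σ≗τ _)))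

  module _ {m : ℕ} {σ : Subst} {f : Fun} {cs ps : Vec Term (fun-arity f)} {ls rs : Vec Term m} where

    Unifies-decompose : Unifies σ (fn f cs ∷ ls) (fn f ps ∷ rs) → Unifies σ (cs ++ᵛ ls) (ps ++ᵛ rs)
    Unifies-decompose u = begin
      (cs ++ᵛ ls) ⟨ σ ⟩*          ≡⟨ ⟨⟩*-++ cs ls σ ⟩
      cs ⟨ σ ⟩* ++ᵛ ls ⟨ σ ⟩*      ≡⟨ cong₂ _++ᵛ_ (fn-injective (Vec.∷-injectiveˡ u)) (Vec.∷-injectiveʳ u) ⟩
      ps ⟨ σ ⟩* ++ᵛ rs ⟨ σ ⟩*      ≡⟨ sym (⟨⟩*-++ ps rs σ) ⟩
      (ps ++ᵛ rs) ⟨ σ ⟩*          ∎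
      where
      open ≡-Reasoning
      fn-injective : ∀ {us vs : Vec Term (fun-arity f)} → fn f us ≡ fn f vs → us ≡ vs
      fn-injective refl = refl

    Unifies-compose : Unifies σ (cs ++ᵛ ls) (ps ++ᵛ rs) → Unifies σ (fn f cs ∷ ls) (fn f ps ∷ rs)
    Unifies-compose u = cong₂ (λ us vs → fn f us ∷ vs) (proj₁ halves) (proj₂ halves)
      where
      halves : cs ⟨ σ ⟩* ≡ ps ⟨ σ ⟩* × ls ⟨ σ ⟩* ≡ rs ⟨ σ ⟩*
      halves = Vec.++-injective (cs ⟨ σ ⟩*) (ps ⟨ σ ⟩*)
                 (trans (sym (⟨⟩*-++ cs ls σ)) (trans u (⟨⟩*-++ ps rs σ)))

  fn-symbol-injective : ∀ {f g us vs} → fn f us ≡ fn g vs → f ≡ g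
  fn-symbol-injective refl = refl

  atom-predicate-injective : ∀ {p p′ ts us} → atom p ts ≡ atom p′ us → p ≡ p′
  atom-predicate-injective refl = refl

  module Solve {J : Set} (P : J → Node) (θ : Subst) {a} (ls₀ rs₀ : Vec Term a) where

    state : ∀ {m} → Subst → Vec Term m → Vec Term m → J ⊎ Fin m → Node
    state ψ ls rs = [ (λ j → P j ⟪ ψ ⟫) , equations ls rs ]′

    -- θ unifies every intermediate system, so an elimination leaves the measure of the remaining
    -- equations unchanged and a decomposition removes one function symbol.
    measure : ∀ {m} → Vec Term m → ℕ
    measure ls = size* (ls ⟨ θ ⟩*)

    record Invariant {m} (ψ : Subst) (ls rs : Vec Term m) : Set where
      field
        tidy      : Tidyᶠ (state ψ ls rs)
        θ-unifies : Unifies θ ls rs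
        θ-absorbs : ∀ x → (ψ ⊙ θ) x ≡ θ x
        sound     : ∀ σ → Unifies σ ls rs → Unifies (ψ ⊙ σ) ls₀ rs₀

    record Step {m} (ls : Vec Term m) : Set where
      field
        {m′}       : ℕ
        ψ′         : Subst
        ls′ rs′    : Vec Term m′
        decreasing : measure ls′ < measure ls
        invariant  : Invariant ψ′ ls′ rs′

    record Solution : Set where
      field
        ψ         : Subst
        tidy      : Tidyᶠ (λ j → P j ⟪ ψ ⟫)
        θ-absorbs : ∀ x → (ψ ⊙ θ) x ≡ θ x
        unifies   : Unifies ψ ls₀ rs₀

    Tidyᶠ-state-◃ : ∀ {m} ψ c p (ls rs : Vec Term m) →
                    Tidyᶠ (state ψ (c ∷ ls) (p ∷ rs)) → Tidyᶠ ((c ≐ p) ◃ state ψ ls rs)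
    Tidyᶠ-state-◃ {m} ψ c p ls rs = Tidyᶠ-reindex h (retraction⇒injective h g g∘h) equal
      where
      h : Maybe (J ⊎ Fin m) → J ⊎ Fin (suc m)
      h nothing         = inj₂ zero
      h (just (inj₁ j)) = inj₁ j
      h (just (inj₂ k)) = inj₂ (suc k)
      g : J ⊎ Fin (suc m) → Maybe (J ⊎ Fin m)
      g (inj₁ j)       = just (inj₁ j)
      g (inj₂ zero)    = nothing
      g (inj₂ (suc k)) = just (inj₂ k)
      g∘h : ∀ i → g (h i) ≡ i
      g∘h nothing         = refl
      g∘h (just (inj₁ j)) = refl
      g∘h (just (inj₂ k)) = refl
      equal : ∀ i → ((c ≐ p) ◃ state ψ ls rs) i ≡ state ψ (c ∷ ls) (p ∷ rs) (h i)
      equal nothing         = refl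
      equal (just (inj₁ j)) = refl
      equal (just (inj₂ k)) = refl

    eliminate : ∀ {m ψ σ c p} {ls rs : Vec Term m} → Invariant ψ (c ∷ ls) (p ∷ rs) →
                Tidyᶠ (λ i → state ψ ls rs i ⟪ σ ⟫) → (∀ x → (σ ⊙ θ) x ≡ θ x) →
                c ⟨ σ ⟩ ≡ p ⟨ σ ⟩ → Step (c ∷ ls)
    eliminate {ψ = ψ} {σ} {c} {p} {ls} {rs} inv T σ-absorbed σ-unifies = record
      { ψ′         = ψ ⊙ σ
      ; ls′        = ls ⟨ σ ⟩*
      ; rs′        = rs ⟨ σ ⟩*
      ; decreasing = subst (_< measure (c ∷ ls)) (sym (cong size* (absorbed ls))) (m<n+m _ (size-positive (c ⟨ θ ⟩)))
      ; invariant  = record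
          { tidy      = Tidyᶠ-cong substituted T
          ; θ-unifies = trans (absorbed ls) (trans (Vec.∷-injectiveʳ θ-unifies) (sym (absorbed rs)))
          ; θ-absorbs = λ x → trans (⟨⟩-⊙ (ψ x) σ θ)
                                (trans (⟨⟩-cong (ψ x) (λ _ → σ-absorbed _)) (θ-absorbs x))
          ; sound     = λ ρ u → Unifies-cong (λ x → sym (⟨⟩-⊙ (ψ x) σ ρ))
                                             (sound (σ ⊙ ρ) (after-σ ρ u)) } }
      where
      open Invariant inv
      absorbed : ∀ {n} (ts : Vec Term n) → ts ⟨ σ ⟩* ⟨ θ ⟩* ≡ ts ⟨ θ ⟩*
      absorbed ts = trans (⟨⟩*-⊙ ts σ θ) (⟨⟩*-cong ts (λ _ → σ-absorbed _))
      substituted : ∀ i → state (ψ ⊙ σ) (ls ⟨ σ ⟩*) (rs ⟨ σ ⟩*) i ≡ state ψ ls rs i ⟪ σ ⟫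
      substituted (inj₁ j) = sym (⟪⟫-⊙ (P j) ψ σ)
      substituted (inj₂ k) = cong₂ _≐_ (lookup-⟨⟩* ls σ k) (lookup-⟨⟩* rs σ k)
      after-σ : ∀ ρ → Unifies ρ (ls ⟨ σ ⟩*) (rs ⟨ σ ⟩*) → Unifies (σ ⊙ ρ) (c ∷ ls) (p ∷ rs)
      after-σ ρ u = cong₂ _∷_
        (trans (sym (⟨⟩-⊙ c σ ρ)) (trans (cong (_⟨ ρ ⟩) σ-unifies) (⟨⟩-⊙ p σ ρ)))
        (trans (sym (⟨⟩*-⊙ ls σ ρ)) (trans u (⟨⟩*-⊙ rs σ ρ)))

    decompose : ∀ {m ψ f} {cs ps : Vec Term (fun-arity f)} {ls rs : Vec Term m} →
                Invariant ψ (fn f cs ∷ ls) (fn f ps ∷ rs) → Step (fn f cs ∷ ls)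
    decompose {m} {ψ} {f} {cs} {ps} {ls} {rs} inv = record
      { ψ′         = ψ
      ; ls′        = cs ++ᵛ ls
      ; rs′        = ps ++ᵛ rs
      ; decreasing = ≤-reflexive (cong suc
                       (trans (cong size* (⟨⟩*-++ cs ls θ)) (size*-++ (cs ⟨ θ ⟩*) (ls ⟨ θ ⟩*))))
      ; invariant  = record
          { tidy      = Tidyᶠ-reindex h (retraction⇒injective h g g∘h) regrouped
                          (Tidyᶠ-decompose f cs ps (Tidyᶠ-state-◃ ψ (fn f cs) (fn f ps) ls rs tidy))
          ; θ-unifies = Unifies-decompose θ-unifies
          ; θ-absorbs = θ-absorbs
          ; sound     = λ σ u → sound σ (Unifies-compose u) } }
      where
      open Invariant inv
      n : ℕ
      n = fun-arity f
      h : J ⊎ Fin (n + m) → (J ⊎ Fin m) ⊎ Fin n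
      h (inj₁ j) = inj₁ (inj₁ j)
      h (inj₂ i) = [ inj₂ , inj₁ ∘ inj₂ ]′ (splitAt n i)
      g : (J ⊎ Fin m) ⊎ Fin n → J ⊎ Fin (n + m)
      g (inj₁ (inj₁ j)) = inj₁ j
      g (inj₁ (inj₂ k)) = inj₂ (n ↑ʳ k)
      g (inj₂ k)        = inj₂ (k ↑ˡ m)
      g∘h : ∀ i → g (h i) ≡ i
      g∘h (inj₁ j) = refl
      g∘h (inj₂ i) with splitAt n i | join-splitAt n m i
      ... | inj₁ k | eq = cong inj₂ eq
      ... | inj₂ k | eq = cong inj₂ eq
      regrouped : ∀ i → state ψ (cs ++ᵛ ls) (ps ++ᵛ rs) i ≡ [ state ψ ls rs , equations cs ps ]′ (h i)
      regrouped (inj₁ j) = refl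
      regrouped (inj₂ i) with splitAt n i | Vec.lookup-splitAt n cs ls i | Vec.lookup-splitAt n ps rs i
      ... | inj₁ k | eq | eq′ = cong₂ _≐_ eq eq′
      ... | inj₂ k | eq | eq′ = cong₂ _≐_ eq eq′

    step : ∀ {m ψ c p} {ls rs : Vec Term m} → Invariant ψ (c ∷ ls) (p ∷ rs) → Step (c ∷ ls)
    step {ψ = ψ} {c} {var X} {ls} {rs} inv =
      eliminate inv (Tidyᶠ-eliminate-output c X T) (↦-⊙-absorb (sym (Vec.∷-injectiveˡ θ-unifies)))
        (trans (⟨↦⟩-∉ c c X∉c) (sym (↦-self X c)))
      where
      open Invariant inv
      T : Tidyᶠ ((c ≐ var X) ◃ state ψ ls rs)
      T = Tidyᶠ-state-◃ ψ c (var X) ls rs tidy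
      X∉c : X ∉ vars c
      X∉c X∈c = Tidyᶠ-outputs∉inputs T nothing (here refl) (∈-++⁺ˡ X∈c)
    step {ψ = ψ} {var V} {fn g ps} {ls} {rs} inv =
      eliminate inv (Tidyᶠ-eliminate-input V (fn g ps) T) (↦-⊙-absorb (Vec.∷-injectiveˡ θ-unifies))
        (trans (↦-self V (fn g ps)) (sym (⟨↦⟩-∉ (fn g ps) (fn g ps) V∉p)))
      where
      open Invariant inv
      T : Tidyᶠ ((var V ≐ fn g ps) ◃ state ψ ls rs)
      T = Tidyᶠ-state-◃ ψ (var V) (fn g ps) ls rs tidy
      V∉p : V ∉ vars (fn g ps)
      V∉p V∈p = Tidyᶠ-outputs∉inputs T nothing (∈-++⁺ˡ V∈p) (here refl)
    step {c = fn f cs} {fn g ps} inv with fn-symbol-injective (Vec.∷-injectiveˡ (Invariant.θ-unifies inv))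
    ... | refl = decompose inv

    solve : ∀ n {m ψ} {ls rs : Vec Term m} → measure ls < n → Invariant ψ ls rs → Solution
    solve n       {ψ = ψ} {[]}    {[]}    _        inv = record
      { ψ         = ψ
      ; tidy      = Tidyᶠ-reindex inj₁ (λ { refl → refl }) (λ _ → refl) tidy
      ; θ-absorbs = θ-absorbs
      ; unifies   = Unifies-cong (λ x → ⟨var⟩ (ψ x)) (sound var refl) }
      where open Invariant inv
    solve (suc n) {ls = _ ∷ _} {_ ∷ _} (s≤s lt) inv = solve n (<-≤-trans decreasing lt) invariant
      where open Step (step inv)

    unify : Tidyᶠ (state var ls₀ rs₀) → Unifies θ ls₀ rs₀ → Solution
    unify T u = solve (suc (measure ls₀)) ≤-refl record
      { tidy = T ; θ-unifies = u ; θ-absorbs = λ _ → refl ; sound = λ _ u′ → u′ }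

  inverse-on-range : ∀ {ψ θ δ} → (∀ x → (ψ ⊙ θ) x ≡ θ x) → (∀ x → ψ x ≡ θ x ⟨ δ ⟩) →
                     ∀ x {y} → y ∈ vars (ψ x) → θ y ⟨ δ ⟩ ≡ var y
  inverse-on-range {ψ} {θ} {δ} absorbs factors x = ⟨⟩-fixed⇒var (ψ x) (begin
    ψ x ⟨ θ ⊙ δ ⟩   ≡⟨ sym (⟨⟩-⊙ (ψ x) θ δ) ⟩
    ψ x ⟨ θ ⟩ ⟨ δ ⟩ ≡⟨ cong (_⟨ δ ⟩) (absorbs x) ⟩
    θ x ⟨ δ ⟩       ≡⟨ sym (factors x) ⟩
    ψ x             ∎)
    where open ≡-Reasoning

  -- The resolvent

  module _ (Q₁ Q₂ B : Query) (p : Pred) (ts us : Vec Term (pred-arity p))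
           (tidyQ : TidyQuery (Q₁ ++ atom p ts ∷ Q₂)) (tidyC : TidyClause (atom p us ← B))
           (apart : VariableDisjoint (Q₁ ++ atom p ts ∷ Q₂) (atom p us ← B)) where

    A H : Atom
    A = atom p ts
    H = atom p us

    Q : Query
    Q = Q₁ ++ A ∷ Q₂

    a : ℕ
    a = pred-arity p

    md : Fin a → Mode
    md = moding p

    RQ : Fin (length Q) → Node
    RQ = node ∘ lookup Q

    RB : Fin (length B) → Node
    RB = node ∘ lookup B

    module TQ = Tidyᶠ (Tidyᶠ-query Q tidyQ)
    module TB = Tidyᶠ (Tidyᶠ-query B (proj₁ tidyC))

    QVar CVar : Var → Set
    QVar x = x ∈ varsQ Q
    CVar x = x ∈ varsC (H ← B)

    inVars⊆varsA : ∀ D {x} → x ∈ inVars D → x ∈ varsA D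
    inVars⊆varsA (atom q vs) = varsᴸ-select⊆vars* (moding q) input vs

    outVars⊆varsA : ∀ D {x} → x ∈ outVars D → x ∈ varsA D
    outVars⊆varsA (atom q vs) = varsᴸ-select⊆vars* (moding q) output vs

    A-var : ∀ k {x} → x ∈ vars (lookupᵛ ts k) → QVar x
    A-var k x∈ = ∈-concatMap-intro varsA (∈-++⁺ʳ Q₁ (here refl)) (vars-lookup⊆vars* ts k x∈)

    H-var : ∀ k {x} → x ∈ vars (lookupᵛ us k) → CVar x
    H-var k x∈ = ∈-++⁺ˡ (vars-lookup⊆vars* us k x∈)

    query-var : ∀ q {x} → x ∈ varsA (lookup Q q) → QVar x
    query-var = lookup-concatMap⊆ varsA Q

    body-var : ∀ b {x} → x ∈ varsA (lookup B b) → CVar x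
    body-var b x∈ = ∈-++⁺ʳ (vars* us) (lookup-concatMap⊆ varsA B b x∈)

    queryIndex : Fin (length Q₁) ⊎ Fin (length Q₂) → Fin (length Q)
    queryIndex q = joinIndex Q₁ (Sum.map₂ suc q)

    iA : Fin (length Q)
    iA = joinIndex Q₁ (inj₂ zero)

    lookup-iA : lookup Q iA ≡ A
    lookup-iA = lookup-joinIndex Q₁ (inj₂ zero)

    queryIndex-injective : ∀ {q q′} → queryIndex q ≡ queryIndex q′ → q ≡ q′
    queryIndex-injective {inj₁ _} {inj₁ _} eq with joinIndex-injective Q₁ eq
    ... | refl = refl
    queryIndex-injective {inj₂ _} {inj₂ _} eq with joinIndex-injective Q₁ eq
    ... | refl = refl
    queryIndex-injective {inj₁ _} {inj₂ _} eq with joinIndex-injective Q₁ eq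
    ... | ()
    queryIndex-injective {inj₂ _} {inj₁ _} eq with joinIndex-injective Q₁ eq
    ... | ()

    queryIndex≢iA : ∀ q → queryIndex q ≢ iA
    queryIndex≢iA (inj₁ _) eq with joinIndex-injective Q₁ eq
    ... | ()
    queryIndex≢iA (inj₂ _) eq with joinIndex-injective Q₁ eq
    ... | ()

    A-output : ∀ k {x} → md k ≡ output → x ∈ vars (lookupᵛ ts k) → x ∈ outVarsᴺ (RQ iA)
    A-output k e x∈ = subst (λ D → _ ∈ outVars D) (sym lookup-iA) (vars-lookup⊆select md output ts k e x∈)

    A-input : ∀ k {x} → md k ≡ input → x ∈ vars (lookupᵛ ts k) → x ∈ inVarsᴺ (RQ iA)
    A-input k e x∈ = subst (λ D → _ ∈ inVars D) (sym lookup-iA) (vars-lookup⊆select md input ts k e x∈)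

    H-inputs-linear : Unique (inVars H)
    H-inputs-linear = proj₁ (proj₂ tidyC)

    H-inputs-fresh : ∀ x → x ∈ inVars H → x ∉ outVarsQ B
    H-inputs-fresh = proj₂ (proj₂ tidyC)

    A-outputs-linear : Unique (outVars A)
    A-outputs-linear = subst (Unique ∘ outVars) lookup-iA (TQ.linear iA)

    -- At an input position the query feeds the clause, at an output position the clause feeds the query.
    flow : Mode → Term → Term → Term × Term
    flow input  t u = t , u
    flow output t u = u , t

    flowAt : Fin a → Term × Term
    flowAt k = flow (md k) (lookupᵛ ts k) (lookupᵛ us k)

    ls₀ rs₀ : Vec Term a
    ls₀ = tabulate (proj₁ ∘ flowAt)
    rs₀ = tabulate (proj₂ ∘ flowAt)

    J : Set
    J = (Fin (length Q₁) ⊎ Fin (length Q₂)) ⊎ Fin (length B)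

    atoms : J → Node
    atoms = [ RQ ∘ queryIndex , RB ]′

    joint : J ⊎ Fin a → Node
    joint = [ atoms , equations ls₀ rs₀ ]′

    toQ : J ⊎ Fin a → Fin (length Q)
    toQ (inj₁ (inj₁ q)) = queryIndex q
    toQ _               = iA

    inVars-equation : ∀ k → inVarsᴺ (joint (inj₂ k)) ≡ vars (proj₁ (flowAt k))
    inVars-equation k = trans (inVars-≐ (lookupᵛ ls₀ k) (lookupᵛ rs₀ k))
                              (cong vars (Vec.lookup∘tabulate (proj₁ ∘ flowAt) k))

    outVars-equation : ∀ k → outVarsᴺ (joint (inj₂ k)) ≡ vars (proj₂ (flowAt k))
    outVars-equation k = trans (outVars-≐ (lookupᵛ ls₀ k) (lookupᵛ rs₀ k))
                               (cong vars (Vec.lookup∘tabulate (proj₂ ∘ flowAt) k))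

    data QueryOutput (x : Var) : J ⊎ Fin a → Set where
      query-atom      : ∀ q → x ∈ outVarsᴺ (RQ (queryIndex q)) → QueryOutput x (inj₁ (inj₁ q))
      output-position : ∀ k → md k ≡ output → x ∈ vars (lookupᵛ ts k) → QueryOutput x (inj₂ k)

    data ClauseOutput (x : Var) : J ⊎ Fin a → Set where
      body-atom      : ∀ b → x ∈ outVarsᴺ (RB b) → ClauseOutput x (inj₁ (inj₂ b))
      input-position : ∀ k → md k ≡ input → x ∈ vars (lookupᵛ us k) → ClauseOutput x (inj₂ k)

    data QueryInput (x : Var) : J ⊎ Fin a → Set where
      query-atom     : ∀ q → x ∈ inVarsᴺ (RQ (queryIndex q)) → QueryInput x (inj₁ (inj₁ q))
      input-position : ∀ k → md k ≡ input → x ∈ vars (lookupᵛ ts k) → QueryInput x (inj₂ k)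

    data ClauseInput (x : Var) : J ⊎ Fin a → Set where
      body-atom       : ∀ b → x ∈ inVarsᴺ (RB b) → ClauseInput x (inj₁ (inj₂ b))
      output-position : ∀ k → md k ≡ output → x ∈ vars (lookupᵛ us k) → ClauseInput x (inj₂ k)

    output-view : ∀ i {x} → x ∈ outVarsᴺ (joint i) → QueryOutput x i ⊎ ClauseOutput x i
    output-view (inj₁ (inj₁ q)) x∈ = inj₁ (query-atom q x∈)
    output-view (inj₁ (inj₂ b)) x∈ = inj₂ (body-atom b x∈)
    output-view (inj₂ k) {x} x∈ = by-mode (md k) refl (subst (x ∈_) (outVars-equation k) x∈)
      where
      by-mode : ∀ m → md k ≡ m → x ∈ vars (proj₂ (flow m (lookupᵛ ts k) (lookupᵛ us k))) →
                QueryOutput x (inj₂ k) ⊎ ClauseOutput x (inj₂ k)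
      by-mode input  e x∈ = inj₂ (input-position k e x∈)
      by-mode output e x∈ = inj₁ (output-position k e x∈)

    input-view : ∀ i {x} → x ∈ inVarsᴺ (joint i) → QueryInput x i ⊎ ClauseInput x i
    input-view (inj₁ (inj₁ q)) x∈ = inj₁ (query-atom q x∈)
    input-view (inj₁ (inj₂ b)) x∈ = inj₂ (body-atom b x∈)
    input-view (inj₂ k) {x} x∈ = by-mode (md k) refl (subst (x ∈_) (inVars-equation k) x∈)
      where
      by-mode : ∀ m → md k ≡ m → x ∈ vars (proj₁ (flow m (lookupᵛ ts k) (lookupᵛ us k))) →
                QueryInput x (inj₂ k) ⊎ ClauseInput x (inj₂ k)
      by-mode input  e x∈ = inj₁ (input-position k e x∈)
      by-mode output e x∈ = inj₂ (output-position k e x∈)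

    QueryOutput⇒QVar : ∀ {x i} → QueryOutput x i → QVar x
    QueryOutput⇒QVar (query-atom q x∈)        = query-var (queryIndex q) (outVars⊆varsA (lookup Q (queryIndex q)) x∈)
    QueryOutput⇒QVar (output-position k _ x∈) = A-var k x∈

    QueryInput⇒QVar : ∀ {x i} → QueryInput x i → QVar x
    QueryInput⇒QVar (query-atom q x∈)       = query-var (queryIndex q) (inVars⊆varsA (lookup Q (queryIndex q)) x∈)
    QueryInput⇒QVar (input-position k _ x∈) = A-var k x∈

    ClauseOutput⇒CVar : ∀ {x i} → ClauseOutput x i → CVar x
    ClauseOutput⇒CVar (body-atom b x∈)        = body-var b (outVars⊆varsA (lookup B b) x∈)
    ClauseOutput⇒CVar (input-position k _ x∈) = H-var k x∈

    ClauseInput⇒CVar : ∀ {x i} → ClauseInput x i → CVar x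
    ClauseInput⇒CVar (body-atom b x∈)         = body-var b (inVars⊆varsA (lookup B b) x∈)
    ClauseInput⇒CVar (output-position k _ x∈) = H-var k x∈

    QueryOutput⇒outVars : ∀ {x i} → QueryOutput x i → x ∈ outVarsᴺ (RQ (toQ i))
    QueryOutput⇒outVars (query-atom q x∈)        = x∈
    QueryOutput⇒outVars (output-position k e x∈) = A-output k e x∈

    QueryInput⇒inVars : ∀ {x i} → QueryInput x i → x ∈ inVarsᴺ (RQ (toQ i))
    QueryInput⇒inVars (query-atom q x∈)       = x∈
    QueryInput⇒inVars (input-position k e x∈) = A-input k e x∈

    ClauseOutput⇒toQ : ∀ {x i} → ClauseOutput x i → toQ i ≡ iA
    ClauseOutput⇒toQ (body-atom _ _)        = refl
    ClauseOutput⇒toQ (input-position _ _ _) = refl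

    ClauseInput⇒toQ : ∀ {x i} → ClauseInput x i → toQ i ≡ iA
    ClauseInput⇒toQ (body-atom _ _)         = refl
    ClauseInput⇒toQ (output-position _ _ _) = refl

    apart-at : ∀ {x} → QVar x → CVar x → ⊥
    apart-at qx cx = apart _ qx cx

    -- Clause variables flow from input positions through the body to output positions, never back.
    ClauseStep : J ⊎ Fin a → J ⊎ Fin a → Set
    ClauseStep i j = ∃ λ x → ClauseOutput x i × ClauseInput x j

    ClauseStep⁺-from-position : ∀ {k j} → TransClosure ClauseStep (inj₂ k) j → md k ≡ input
    ClauseStep⁺-from-position [ _ , input-position _ e _ , _ ]     = e
    ClauseStep⁺-from-position ((_ , input-position _ e _ , _) ∷ _) = e

    ClauseStep⁺-into-position : ∀ {i k} → TransClosure ClauseStep i (inj₂ k) → md k ≡ output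
    ClauseStep⁺-into-position [ _ , _ , output-position _ e _ ] = e
    ClauseStep⁺-into-position (_ ∷ rest)                        = ClauseStep⁺-into-position rest

    ClauseStep⁺-between-body : ∀ {b b′} → TransClosure ClauseStep (inj₁ (inj₂ b)) (inj₁ (inj₂ b′)) →
                               TransClosure (Arrowᶠ RB) b b′
    ClauseStep⁺-between-body [ x , body-atom _ x∈ , body-atom _ x∈′ ] = [ x , x∈ , x∈′ ]
    ClauseStep⁺-between-body ((x , body-atom _ x∈ , body-atom _ x∈′) ∷ rest) =
      (x , x∈ , x∈′) ∷ ClauseStep⁺-between-body rest
    ClauseStep⁺-between-body ((_ , body-atom _ _ , output-position _ e _) ∷ rest)
      with trans (sym e) (ClauseStep⁺-from-position rest)
    ... | ()

    ClauseStep-acyclic : IsAcyclic ClauseStep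
    ClauseStep-acyclic (inj₁ (inj₁ q)) [ _ , () , _ ]
    ClauseStep-acyclic (inj₁ (inj₁ q)) ((_ , () , _) ∷ _)
    ClauseStep-acyclic (inj₁ (inj₂ b)) cycle = TB.acyclic b (ClauseStep⁺-between-body cycle)
    ClauseStep-acyclic (inj₂ k)        cycle
      with trans (sym (ClauseStep⁺-from-position cycle)) (ClauseStep⁺-into-position cycle)
    ... | ()

    classify : ∀ {i j} → Arrowᶠ joint i j → Arrowᶠ RQ (toQ i) (toQ j) ⊎ (ClauseStep i j × toQ i ≡ toQ j)
    classify {i} {j} (x , x∈out , x∈in) with output-view i x∈out | input-view j x∈in
    ... | inj₁ qo | inj₁ qi = inj₁ (x , QueryOutput⇒outVars qo , QueryInput⇒inVars qi)
    ... | inj₁ qo | inj₂ ci = ⊥-elim (apart-at (QueryOutput⇒QVar qo) (ClauseInput⇒CVar ci))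
    ... | inj₂ co | inj₁ qi = ⊥-elim (apart-at (QueryInput⇒QVar qi) (ClauseOutput⇒CVar co))
    ... | inj₂ co | inj₂ ci = inj₂ ((x , co , ci) , trans (ClauseOutput⇒toQ co) (sym (ClauseInput⇒toQ ci)))

    query-outputs-disjoint : ∀ {x i j} → QueryOutput x i → QueryOutput x j → i ≡ j
    query-outputs-disjoint (query-atom q x∈) (query-atom q′ x∈′) =
      cong (inj₁ ∘ inj₁) (queryIndex-injective (TQ.disjoint x∈ x∈′))
    query-outputs-disjoint (query-atom q x∈) (output-position k e x∈′) =
      ⊥-elim (queryIndex≢iA q (TQ.disjoint x∈ (A-output k e x∈′)))
    query-outputs-disjoint (output-position k e x∈) (query-atom q x∈′) =
      ⊥-elim (queryIndex≢iA q (TQ.disjoint x∈′ (A-output k e x∈)))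
    query-outputs-disjoint (output-position k e x∈) (output-position k′ e′ x∈′) =
      cong inj₂ (select-lookup-injective md output ts e e′ A-outputs-linear x∈ x∈′)

    clause-outputs-disjoint : ∀ {x i j} → ClauseOutput x i → ClauseOutput x j → i ≡ j
    clause-outputs-disjoint (body-atom b x∈) (body-atom b′ x∈′) =
      cong (inj₁ ∘ inj₂) (TB.disjoint x∈ x∈′)
    clause-outputs-disjoint (body-atom b x∈) (input-position k e x∈′) =
      ⊥-elim (H-inputs-fresh _ (vars-lookup⊆select md input us k e x∈′) (lookup-concatMap⊆ outVars B b x∈))
    clause-outputs-disjoint (input-position k e x∈) (body-atom b x∈′) =
      ⊥-elim (H-inputs-fresh _ (vars-lookup⊆select md input us k e x∈) (lookup-concatMap⊆ outVars B b x∈′))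
    clause-outputs-disjoint (input-position k e x∈) (input-position k′ e′ x∈′) =
      cong inj₂ (select-lookup-injective md input us e e′ H-inputs-linear x∈ x∈′)

    joint-tidy : Tidyᶠ joint
    joint-tidy = record
      { outputLinear = record { linear = linear ; disjoint = disjoint }
      ; acyclic      = IsAcyclic-collapse toQ classify TQ.acyclic ClauseStep-acyclic }
      where
      linear : ∀ i → Unique (outVarsᴺ (joint i))
      linear (inj₁ (inj₁ q)) = TQ.linear (queryIndex q)
      linear (inj₁ (inj₂ b)) = TB.linear b
      linear (inj₂ k)        = subst Unique (sym (outVars-equation k)) (by-mode (md k) refl)
        where
        by-mode : ∀ m → md k ≡ m → Unique (vars (proj₂ (flow m (lookupᵛ ts k) (lookupᵛ us k))))
        by-mode input  e = Unique-select-lookup md input us k e H-inputs-linear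
        by-mode output e = Unique-select-lookup md output ts k e A-outputs-linear
      disjoint : ∀ {i j x} → x ∈ outVarsᴺ (joint i) → x ∈ outVarsᴺ (joint j) → i ≡ j
      disjoint {i} {j} x∈ x∈′ with output-view i x∈ | output-view j x∈′
      ... | inj₁ qo | inj₁ qo′ = query-outputs-disjoint qo qo′
      ... | inj₂ co | inj₂ co′ = clause-outputs-disjoint co co′
      ... | inj₁ qo | inj₂ co′ = ⊥-elim (apart-at (QueryOutput⇒QVar qo) (ClauseOutput⇒CVar co′))
      ... | inj₂ co | inj₁ qo′ = ⊥-elim (apart-at (QueryOutput⇒QVar qo′) (ClauseOutput⇒CVar co))

    lookup-flow : ∀ σ k → lookupᵛ (ls₀ ⟨ σ ⟩*) k ≡ proj₁ (flowAt k) ⟨ σ ⟩ ×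
                          lookupᵛ (rs₀ ⟨ σ ⟩*) k ≡ proj₂ (flowAt k) ⟨ σ ⟩
    lookup-flow σ k =
      trans (lookup-⟨⟩* ls₀ σ k) (cong (_⟨ σ ⟩) (Vec.lookup∘tabulate (proj₁ ∘ flowAt) k)) ,
      trans (lookup-⟨⟩* rs₀ σ k) (cong (_⟨ σ ⟩) (Vec.lookup∘tabulate (proj₂ ∘ flowAt) k))

    Unifies⇒unifies-atoms : ∀ σ → Unifies σ ls₀ rs₀ → A ⟨ σ ⟩ₐ ≡ H ⟨ σ ⟩ₐ
    Unifies⇒unifies-atoms σ u = cong (atom p) (lookupᵛ-extensionality λ k →
      trans (lookup-⟨⟩* ts σ k) (trans (unflow (md k) (at k)) (sym (lookup-⟨⟩* us σ k))))
      where
      at : ∀ k → proj₁ (flowAt k) ⟨ σ ⟩ ≡ proj₂ (flowAt k) ⟨ σ ⟩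
      at k = trans (sym (proj₁ (lookup-flow σ k)))
                   (trans (cong (λ vs → lookupᵛ vs k) u) (proj₂ (lookup-flow σ k)))
      unflow : ∀ m {t u} → proj₁ (flow m t u) ⟨ σ ⟩ ≡ proj₂ (flow m t u) ⟨ σ ⟩ → t ⟨ σ ⟩ ≡ u ⟨ σ ⟩
      unflow input  eq = eq
      unflow output eq = sym eq

    unifies-atoms⇒Unifies : ∀ σ → A ⟨ σ ⟩ₐ ≡ H ⟨ σ ⟩ₐ → Unifies σ ls₀ rs₀
    unifies-atoms⇒Unifies σ eq = lookupᵛ-extensionality λ k →
      trans (proj₁ (lookup-flow σ k)) (trans (inflow (md k) (at k)) (sym (proj₂ (lookup-flow σ k))))
      where
      arguments : ts ⟨ σ ⟩* ≡ us ⟨ σ ⟩*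
      arguments = atom-injective eq
        where
        atom-injective : ∀ {xs ys : Vec Term a} → atom p xs ≡ atom p ys → xs ≡ ys
        atom-injective refl = refl
      at : ∀ k → lookupᵛ ts k ⟨ σ ⟩ ≡ lookupᵛ us k ⟨ σ ⟩
      at k = trans (sym (lookup-⟨⟩* ts σ k))
                   (trans (cong (λ vs → lookupᵛ vs k) arguments) (lookup-⟨⟩* us σ k))
      inflow : ∀ m {t u} → t ⟨ σ ⟩ ≡ u ⟨ σ ⟩ → proj₁ (flow m t u) ⟨ σ ⟩ ≡ proj₂ (flow m t u) ⟨ σ ⟩
      inflow input  eq = eq
      inflow output eq = sym eq

    atoms-tidy-after-mgu : ∀ θ → IsMGU θ A H → Tidyᶠ (λ j → atoms j ⟪ θ ⟫)
    atoms-tidy-after-mgu θ (θ-unifies , θ-general) =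
      Tidyᶠ-cong absorbed (Tidyᶠ-rename θ δ (λ {j} → δ-inverts {j}) tidy)
      where
      open Solve atoms θ ls₀ rs₀
      initial : ∀ i → state var ls₀ rs₀ i ≡ joint i
      initial (inj₁ j) = ⟪var⟫ (atoms j)
      initial (inj₂ k) = refl
      open Solution (unify (Tidyᶠ-cong initial joint-tidy) (unifies-atoms⇒Unifies θ θ-unifies))
      factor : Σ Subst λ δ → ∀ x → ψ x ≡ θ x ⟨ δ ⟩
      factor = θ-general ψ (Unifies⇒unifies-atoms ψ unifies)
      δ : Subst
      δ = proj₁ factor
      δ-inverts : ∀ {j y} → y ∈ᴺ (atoms j ⟪ ψ ⟫) → θ y ⟨ δ ⟩ ≡ var y
      δ-inverts {j} (inj₁ y∈) = let x , _ , y∈ψx = ∈-inVars-⟪⟫⁻ (atoms j) ψ y∈ in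
                               inverse-on-range θ-absorbs (proj₂ factor) x y∈ψx
      δ-inverts {j} (inj₂ y∈) = let x , _ , y∈ψx = ∈-outVars-⟪⟫⁻ (atoms j) ψ y∈ in
                               inverse-on-range θ-absorbs (proj₂ factor) x y∈ψx
      absorbed : ∀ j → atoms j ⟪ θ ⟫ ≡ atoms j ⟪ ψ ⟫ ⟪ θ ⟫
      absorbed j = sym (trans (⟪⟫-⊙ (atoms j) ψ θ) (⟪⟫-cong (atoms j) θ-absorbs))

    resolventIndex : Fin (length (Q₁ ++ B ++ Q₂)) → J
    resolventIndex l = fromSplit (splitIndex Q₁ l)
      where
      fromSplit : Fin (length Q₁) ⊎ Fin (length (B ++ Q₂)) → J
      fromSplit (inj₁ i) = inj₁ (inj₁ i)
      fromSplit (inj₂ r) = [ inj₂ , inj₁ ∘ inj₂ ]′ (splitIndex B r)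

    resolventIndex⁻¹ : J → Fin (length (Q₁ ++ B ++ Q₂))
    resolventIndex⁻¹ (inj₁ (inj₁ i)) = joinIndex Q₁ (inj₁ i)
    resolventIndex⁻¹ (inj₁ (inj₂ i)) = joinIndex Q₁ (inj₂ (joinIndex B (inj₂ i)))
    resolventIndex⁻¹ (inj₂ b)        = joinIndex Q₁ (inj₂ (joinIndex B (inj₁ b)))

    resolventIndex⁻¹-retraction : ∀ l → resolventIndex⁻¹ (resolventIndex l) ≡ l
    resolventIndex⁻¹-retraction l with splitIndex Q₁ l | joinIndex-splitIndex Q₁ l
    ... | inj₁ i | eq = eq
    ... | inj₂ r | eq with splitIndex B r | joinIndex-splitIndex B r
    ...   | inj₁ b | eq′ = trans (cong (joinIndex Q₁ ∘ inj₂) eq′) eq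
    ...   | inj₂ i | eq′ = trans (cong (joinIndex Q₁ ∘ inj₂) eq′) eq

    atoms-resolventIndex : ∀ l → atoms (resolventIndex l) ≡ node (lookup (Q₁ ++ B ++ Q₂) l)
    atoms-resolventIndex l with splitIndex Q₁ l | lookup-splitIndex Q₁ l
    ... | inj₁ i | eq = cong node (trans (lookup-joinIndex Q₁ (inj₁ i)) (sym eq))
    ... | inj₂ r | eq with splitIndex B r | lookup-splitIndex B r
    ...   | inj₁ b | eq′ = cong node (sym (trans eq eq′))
    ...   | inj₂ i | eq′ = cong node (trans (lookup-joinIndex Q₁ (inj₂ (suc i))) (sym (trans eq eq′)))

    resolvent-tidy : ∀ θ → IsMGU θ A H → TidyQuery ((Q₁ ++ B ++ Q₂) ⟨ θ ⟩q)
    resolvent-tidy θ mgu =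
      TidyQuery-family (L ⟨ θ ⟩q) (Tidyᶠ-reindex index injective equal (atoms-tidy-after-mgu θ mgu))
      where
      L : Query
      L = Q₁ ++ B ++ Q₂
      index : Fin (length (L ⟨ θ ⟩q)) → J
      index = resolventIndex ∘ ⟨⟩q-index L θ
      injective : ∀ {i j} → index i ≡ index j → i ≡ j
      injective = ⟨⟩q-index-injective L θ ∘
                  retraction⇒injective resolventIndex resolventIndex⁻¹ resolventIndex⁻¹-retraction
      equal : ∀ i → node (lookup (L ⟨ θ ⟩q) i) ≡ atoms (index i) ⟪ θ ⟫
      equal i = begin
        node (lookup (L ⟨ θ ⟩q) i)                ≡⟨ cong node (lookup-⟨⟩q L θ i) ⟩
        node (lookup L (⟨⟩q-index L θ i) ⟨ θ ⟩ₐ)  ≡⟨ node-⟨⟩ (lookup L (⟨⟩q-index L θ i)) θ ⟩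
        node (lookup L (⟨⟩q-index L θ i)) ⟪ θ ⟫   ≡⟨ cong (_⟪ θ ⟫) (atoms-resolventIndex (⟨⟩q-index L θ i)) ⟨
        atoms (index i) ⟪ θ ⟫                     ∎
        where open ≡-Reasoning

lemma3 : (Sg : Signature) (m : Moding Sg)
         (Q : LP.Query Sg m) (C : LP.Clause Sg m) (Q' : LP.Query Sg m) →
         LP.TidyQuery Sg m Q → LP.TidyClause Sg m C →
         LP.VariableDisjoint Sg m Q C →
         LP.SLDResolvent Sg m Q C Q' →
         LP.TidyQuery Sg m Q'
lemma3 Sg m Q (LP.atom p′ us LP.← B) Q' tidyQ tidyC apart (Q₁ , LP.atom p ts , Q₂ , θ , refl , mgu , refl)
  with Tidiness.atom-predicate-injective Sg m (proj₁ mgu)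
... | refl = Tidiness.resolvent-tidy Sg m Q₁ Q₂ B p ts us tidyQ tidyC apart θ mgu
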